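{- Let $$M(X,Y,A,B)=\sum_{n=1}^\infty X^n\sum_{\alpha,\beta\in\mathrm{Int}(n)}Y^{\|\alpha^{ -1}\beta\|}A^{\|\alpha\|}B^{\|\beta\|}$$ and $$K(X,Y,A,B)=\sum_{n=1}^\infty X^n\sum_{\substack{\alpha,\beta\in\mathrm{KrInt}(n)\\ \alpha\wedge_{\mathrm{KrInt}}\beta=0_n}}Y^{\|\alpha^{ -1}\beta\|}A^{\|\alpha^{ -1}\gamma_n\|}B^{\|\beta^{ -1}\gamma_n\|}.$$ Then $$M(X,Y,A,B)=\frac{X}{1-X(1+AB+(A+B)Y)},\qquad K(X,Y,A,B)=\frac{X}{1-X(AB+(A+B)Y)}.$$
   Context: $\mathcal S_n$ is the symmetric group on $[n]$; $\#\alpha$ is the number of cycles of $\alpha$ and $\|\alpha\|=n-\#\alpha$. $\gamma_n=(1\,2\,\cdots\,n)$ is the full cycle and $0_n$ the identity. $\mathrm{NC}(n)$ is the set of non-crossing partitions of $[n]$, each identified with the permutation whose cycles are its blocks with elements in increasing order; $\mathrm{Int}(n)\subseteq\mathrm{NC}(n)$ is the set of interval partitions (blocks of consecutive integers). $\mathrm{NC}(n)$ is ordered by $\rho\le\sigma$ iff each block of $\rho$ lies in a block of $\sigma$. The Kreweras complement of $\alpha\in\mathrm{NC}(n)$ is $\alpha^{\mathrm{Kr}}=\alpha^{ -1}\gamma_n\in\mathrm{NC}(n)$, and $\mathrm{KrInt}(n)=\{\alpha^{\mathrm{Kr}}:\alpha\in\mathrm{Int}(n)\}$. For $\alpha,\beta\in\mathrm{NC}(n)$,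 $\alpha\wedge_{\mathrm{KrInt}}\beta=\max\{\rho\in\mathrm{KrInt}(n):\rho\le\alpha,\rho\le\beta\}$. -}

module Defs where

open import Level using (Level)
open import Data.Nat as ℕ using (ℕ; zero; suc; _∸_; _≡ᵇ_; _≤ᵇ_)
open import Data.Nat.DivMod using (_%_; m%n<n)
open import Data.Fin as F using (Fin; toℕ)
open import Data.Bool using (Bool; true; false; _∧_; _∨_; not; if_then_else_)
open import Data.Vec using (Vec; []; _∷_)
open import Data.List as L using (List; []; _∷_; allFin; upTo; concatMap; foldr; length; filterᵇ)
open import Algebra.Bundles using (CommutativeSemiring)

-- Permutations of [n] are represented as functions Fin n → Fin n,
-- with [n] = {1,...,n} encoded as Fin n = {0,...,n-1} (i ↦ i-1).
Perm : ℕ → Set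
Perm n = Fin n → Fin n

allB : {A : Set} → List A → (A → Bool) → Bool
allB xs p = foldr (λ x r → p x ∧ r) true xs

anyB : {A : Set} → List A → (A → Bool) → Bool
anyB xs p = foldr (λ x r → p x ∨ r) false xs

_==_ : {n : ℕ} → Fin n → Fin n → Bool
i == j = toℕ i ≡ᵇ toℕ j

_·_ : {n : ℕ} → Perm n → Perm n → Perm n
(α · β) i = α (β i)

iter : {n : ℕ} → ℕ → Perm n → Fin n → Fin n
iter zero α i = i
iter (suc k) α i = α (iter k α i)

findL : {n : ℕ} → List (Fin n) → (Fin n → Bool) → Fin n → Fin n
findL [] p d = d
findL (x ∷ xs) p d = if p x then x else findL xs p d

inv : {n : ℕ} → Perm n → Perm n
inv {n} α j = findL (allFin n) (λ i → α i == j) j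

idP : {n : ℕ} → Perm n
idP i = i

isCycleMin : {n : ℕ} → Perm n → Fin n → Bool
isCycleMin {n} α i = allB (upTo n) (λ k → toℕ i ≤ᵇ toℕ (iter k α i))

numCycles : {n : ℕ} → Perm n → ℕ
numCycles {n} α = length (filterᵇ (isCycleMin α) (allFin n))

‖_‖ : {n : ℕ} → Perm n → ℕ
‖_‖ {n} α = n ∸ numCycles α

finOf : {m : ℕ} → ℕ → Fin (suc m)
finOf {m} k = F.fromℕ< (m%n<n k (suc m))

γ : {m : ℕ} → Perm (suc m)
γ i = finOf (suc (toℕ i))

-- Interval partitions of [m+1]: encoded by a cut vector c : Vec Bool m,
-- where the p-th entry (0-indexed) is true iff positions p and p+1
-- (0-indexed) lie in different blocks.  This is a bijection between
-- Vec Bool m and Int(m+1).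
cutAt : {m : ℕ} → Vec Bool m → ℕ → Bool
cutAt [] _ = true
cutAt (b ∷ _) zero = b
cutAt (_ ∷ v) (suc p) = cutAt v p

blockStart : {m : ℕ} → Vec Bool m → ℕ → ℕ
blockStart c zero = zero
blockStart c (suc p) = if cutAt c p then suc p else blockStart c p

-- the permutation of the interval partition: each block {s,...,e} becomes
-- the cycle (s s+1 ... e) (elements in increasing order)
intPerm : {m : ℕ} → Vec Bool m → Perm (suc m)
intPerm c i = if cutAt c (toℕ i) then finOf (blockStart c (toℕ i)) else finOf (suc (toℕ i))

-- all cut vectors; Int(m+1) = { intPerm c | c ∈ allCuts m }, each once
allCuts : (m : ℕ) → List (Vec Bool m)
allCuts zero = [] ∷ []
allCuts (suc m) = concatMap (λ v → (false ∷ v) ∷ (true ∷ v) ∷ []) (allCuts m)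

kr : {m : ℕ} → Perm (suc m) → Perm (suc m)
kr α = inv α · γ

-- KrInt(m+1) = { (intPerm c)^Kr | c ∈ allCuts m }
krIntPerm : {m : ℕ} → Vec Bool m → Perm (suc m)
krIntPerm c = kr (intPerm c)

eqP : {n : ℕ} → Perm n → Perm n → Bool
eqP {n} ρ σ = allB (allFin n) (λ i → ρ i == σ i)

sameBlock : {n : ℕ} → Perm n → Fin n → Fin n → Bool
sameBlock {n} σ i j = anyB (upTo n) (λ k → iter k σ i == j)

leqP : {n : ℕ} → Perm n → Perm n → Bool
leqP {n} ρ σ = allB (allFin n) (λ i → sameBlock σ i (ρ i))

inKrInt : {m : ℕ} → Perm (suc m) → Bool
inKrInt {m} ρ = anyB (allCuts m) (λ c → eqP ρ (krIntPerm c))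

-- α ∧_KrInt β = 0_n : 0_n is the maximum of
-- { ρ ∈ KrInt(n) : ρ ≤ α, ρ ≤ β }
meetKrIntIsZero : {m : ℕ} → Perm (suc m) → Perm (suc m) → Bool
meetKrIntIsZero {m} α β =
  (inKrInt {m} idP ∧ leqP idP α ∧ leqP idP β)
  ∧ allB (allCuts m) (λ c →
      let ρ = krIntPerm c in
      if leqP ρ α ∧ leqP ρ β then leqP ρ idP else true)

module Series {c ℓ : Level} (R : CommutativeSemiring c ℓ) where
  open CommutativeSemiring R

  pow : Carrier → ℕ → Carrier
  pow x zero = 1#
  pow x (suc k) = x * pow x k

  sumL : {A : Set} → List A → (A → Carrier) → Carrier
  sumL xs f = foldr (λ x r → f x + r) 0# xs

  -- coefficient of X^(m+1) in M(X,Y,A,B), at Y = y, A = a, B = b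
  Mcoeff : Carrier → Carrier → Carrier → ℕ → Carrier
  Mcoeff y a b m =
    sumL (allCuts m) λ c → sumL (allCuts m) λ d →
      let α = intPerm c ; β = intPerm d in
      pow y ‖ inv α · β ‖ * pow a ‖ α ‖ * pow b ‖ β ‖

  -- coefficient of X^(m+1) in K(X,Y,A,B), at Y = y, A = a, B = b
  Kcoeff : Carrier → Carrier → Carrier → ℕ → Carrier
  Kcoeff y a b m =
    sumL (allCuts m) λ c → sumL (allCuts m) λ d →
      let α = krIntPerm c ; β = krIntPerm d in
      if meetKrIntIsZero α β
        then pow y ‖ inv α · β ‖ * pow a ‖ inv α · γ ‖ * pow b ‖ inv β · γ ‖
        else 0#

module Submission where

-- Prepending one bit extends intPerm c,
-- its Kreweras complement and γ by a new point 0, either as a fixed point or by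
-- inserting 0 into an existing cycle; the first adds a cycle, the second does not.
-- Following α σ = β bit by bit gives σ = α⁻¹β explicitly, and shows that ‖intPerm c‖
-- and ‖(krIntPerm c)⁻¹ γ‖ count the non-cuts of c while ‖α⁻¹β‖ is the Hamming distance
-- of the cut vectors (for Kreweras complements provided the cut sets are disjoint). Also
-- refinement of Kreweras complements is inclusion of cut sets, so their KrInt-meet
-- is 0ₙ exactly when the cut sets are disjoint. Hence both double sums factor over
-- the m positions, each contributing 1 + ab + (a+b)y, resp. ab + (a+b)y once a cut
-- in both vectors at the same position is excluded.

open import Defs
open import Level using (Level)
open import Data.Nat as ℕ using (ℕ; zero; suc; _∸_; _≤_; _<_; z≤n; s≤s; _≤ᵇ_; _%_)
import Data.Nat.Properties as ℕₚ
open import Data.Nat.DivMod using (m%n<n; m<n⇒m%n≡m; n%n≡0)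
open import Data.Fin as Fin using (Fin; toℕ; fromℕ)
import Data.Fin.Properties as Finₚ
open import Data.Bool using (Bool; true; false; _∧_; _∨_; _xor_; not; if_then_else_; T)
open import Data.Bool.Properties using (∧-assoc; ∨-assoc; ∧-identityʳ; ∧-zeroʳ)
open import Data.Vec using (Vec; []; _∷_; _∷ʳ_)
open import Data.List using (List; []; _∷_; allFin; upTo; length; filterᵇ; tabulate; applyUpTo; concatMap)
open import Data.Product using (_×_; _,_; proj₁; proj₂; ∃-syntax)
open import Data.Sum using (_⊎_; inj₁; inj₂)
open import Data.Empty using (⊥-elim)
open import Relation.Nullary using (¬_)
open import Relation.Binary.PropositionalEquality using (_≡_; _≢_; refl; sym; trans; cong; cong₂; subst; _≗_; module ≡-Reasoning)
open import Relation.Binary.Definitions using (tri<; tri≈; tri>)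
open import Function.Definitions using (Injective)
open import Function.Bundles using (_⇔_; mk⇔; Equivalence)
open import Algebra.Bundles using (CommutativeSemiring)

private variable
  m n : ℕ

true≢false : true ≢ false
true≢false ()

T⇒≡true : ∀ {b} → T b → b ≡ true
T⇒≡true {true} _ = refl

≡true⇒T : ∀ {b} → b ≡ true → T b
≡true⇒T refl = _

≡true-ext : ∀ {b c} → (b ≡ true → c ≡ true) → (c ≡ true → b ≡ true) → b ≡ c
≡true-ext {true} {true} f g = refl
≡true-ext {true} {false} f g = sym (f refl)
≡true-ext {false} {true} f g = g refl
≡true-ext {false} {false} f g = refl

∧≡true⁻ : ∀ {a b} → a ∧ b ≡ true → a ≡ true × b ≡ true
∧≡true⁻ {true} {true} _ = refl , refl

∧≡true⁺ : ∀ {a b} → a ≡ true → b ≡ true → a ∧ b ≡ true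
∧≡true⁺ refl refl = refl

not≡true⇒≡false : ∀ {a} → not a ≡ true → a ≡ false
not≡true⇒≡false {false} _ = refl

≡false⇒not≡true : ∀ {a} → a ≡ false → not a ≡ true
≡false⇒not≡true refl = refl

≢true⇒≡false : ∀ {a} → a ≢ true → a ≡ false
≢true⇒≡false {true} h = ⊥-elim (h refl)
≢true⇒≡false {false} h = refl

==⇒≡ : {i j : Fin n} → i == j ≡ true → i ≡ j
==⇒≡ {i = i} {j} e = Finₚ.toℕ-injective (ℕₚ.≡ᵇ⇒≡ (toℕ i) (toℕ j) (≡true⇒T e))

==-refl : (i : Fin n) → i == i ≡ true
==-refl i = T⇒≡true (ℕₚ.≡⇒≡ᵇ (toℕ i) (toℕ i) refl)

data ==-View (i j : Fin n) : Set where
  equal   : i ≡ j → i == j ≡ true → ==-View i j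
  unequal : i ≢ j → i == j ≡ false → ==-View i j

==-view : (i j : Fin n) → ==-View i j
==-view i j with i == j in e
... | true = equal (==⇒≡ e) e
... | false = unequal (λ { refl → true≢false (trans (sym (==-refl i)) e) }) e

Fin1-≡ : (i j : Fin 1) → i ≡ j
Fin1-≡ Fin.zero Fin.zero = refl

allB-cong : {A : Set} (xs : List A) {p q : A → Bool} → (∀ x → p x ≡ q x) → allB xs p ≡ allB xs q
allB-cong [] h = refl
allB-cong (x ∷ xs) h = cong₂ _∧_ (h x) (allB-cong xs h)

anyB-cong : {A : Set} (xs : List A) {p q : A → Bool} → (∀ x → p x ≡ q x) → anyB xs p ≡ anyB xs q
anyB-cong [] h = refl
anyB-cong (x ∷ xs) h = cong₂ _∨_ (h x) (anyB-cong xs h)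

allB-applyUpTo⁻ : ∀ n (f : ℕ → ℕ) (p : ℕ → Bool) → allB (applyUpTo f n) p ≡ true →
  ∀ k → k < n → p (f k) ≡ true
allB-applyUpTo⁻ (suc n) f p h zero _ = proj₁ (∧≡true⁻ h)
allB-applyUpTo⁻ (suc n) f p h (suc k) (s≤s k<n) =
  allB-applyUpTo⁻ n (λ x → f (suc x)) p (proj₂ (∧≡true⁻ {p (f 0)} h)) k k<n

allB-applyUpTo⁺ : ∀ n (f : ℕ → ℕ) (p : ℕ → Bool) → (∀ k → k < n → p (f k) ≡ true) →
  allB (applyUpTo f n) p ≡ true
allB-applyUpTo⁺ zero f p h = refl
allB-applyUpTo⁺ (suc n) f p h =
  ∧≡true⁺ (h zero (s≤s z≤n)) (allB-applyUpTo⁺ n (λ x → f (suc x)) p (λ k k<n → h (suc k) (s≤s k<n)))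

anyB-applyUpTo⁻ : ∀ n (f : ℕ → ℕ) (p : ℕ → Bool) → anyB (applyUpTo f n) p ≡ true →
  ∃[ k ] k < n × p (f k) ≡ true
anyB-applyUpTo⁻ (suc n) f p h with p (f 0) in e
... | true = zero , s≤s z≤n , e
... | false with anyB-applyUpTo⁻ n (λ x → f (suc x)) p h
... | k , k<n , pk = suc k , s≤s k<n , pk

anyB-applyUpTo⁺ : ∀ n (f : ℕ → ℕ) (p : ℕ → Bool) k → k < n → p (f k) ≡ true →
  anyB (applyUpTo f n) p ≡ true
anyB-applyUpTo⁺ (suc n) f p zero _ e rewrite e = refl
anyB-applyUpTo⁺ (suc n) f p (suc k) (s≤s k<n) e with p (f 0)
... | true = refl
... | false = anyB-applyUpTo⁺ n (λ x → f (suc x)) p k k<n e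

allB-tabulate⁻ : {A : Set} (f : Fin n → A) (p : A → Bool) → allB (tabulate f) p ≡ true →
  ∀ i → p (f i) ≡ true
allB-tabulate⁻ f p h Fin.zero = proj₁ (∧≡true⁻ h)
allB-tabulate⁻ f p h (Fin.suc i) = allB-tabulate⁻ (λ x → f (Fin.suc x)) p (proj₂ (∧≡true⁻ {p (f Fin.zero)} h)) i

allB-tabulate⁺ : {A : Set} (f : Fin n → A) (p : A → Bool) → (∀ i → p (f i) ≡ true) →
  allB (tabulate f) p ≡ true
allB-tabulate⁺ {zero} f p h = refl
allB-tabulate⁺ {suc n} f p h = ∧≡true⁺ (h Fin.zero) (allB-tabulate⁺ (λ x → f (Fin.suc x)) p (λ i → h (Fin.suc i)))

count : (Fin n → Bool) → ℕ
count {zero} p = zero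
count {suc n} p = (if p Fin.zero then 1 else 0) ℕ.+ count (λ i → p (Fin.suc i))

length-filter-tabulate : {A : Set} (f : Fin n → A) (p : A → Bool) →
  length (filterᵇ p (tabulate f)) ≡ count (λ i → p (f i))
length-filter-tabulate {zero} f p = refl
length-filter-tabulate {suc n} f p with p (f Fin.zero)
... | true = cong suc (length-filter-tabulate (λ x → f (Fin.suc x)) p)
... | false = length-filter-tabulate (λ x → f (Fin.suc x)) p

numCycles≡count : (α : Perm n) → numCycles α ≡ count (isCycleMin α)
numCycles≡count α = length-filter-tabulate (λ i → i) (isCycleMin α)

count-cong : {p q : Fin n → Bool} → (∀ i → p i ≡ q i) → count p ≡ count q
count-cong {zero} h = refl
count-cong {suc n} h = cong₂ ℕ._+_ (cong (λ b → if b then 1 else 0) (h Fin.zero)) (count-cong (λ i → h (Fin.suc i)))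

count-suc : (p : Fin (suc n) → Bool) → p Fin.zero ≡ true → count p ≡ suc (count (λ i → p (Fin.suc i)))
count-suc p e rewrite e = refl

count-none : (p : Fin n → Bool) → (∀ i → p i ≡ false) → count p ≡ 0
count-none {zero} p h = refl
count-none {suc n} p h rewrite h Fin.zero = count-none (λ i → p (Fin.suc i)) (λ i → h (Fin.suc i))

count-unique : (p : Fin n → Bool) (i₀ : Fin n) → (∀ i → p i ≡ true → i ≡ i₀) → p i₀ ≡ true → count p ≡ 1
count-unique {suc n} p Fin.zero h e rewrite e =
  cong suc (count-none (λ i → p (Fin.suc i)) (λ i → ≢true⇒≡false (λ pi → Finₚ.0≢1+n (sym (h (Fin.suc i) pi)))))
count-unique {suc n} p (Fin.suc i₀) h e rewrite ≢true⇒≡false {p Fin.zero} (λ p0 → Finₚ.0≢1+n (h Fin.zero p0)) =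
  count-unique (λ i → p (Fin.suc i)) i₀ (λ i pi → Finₚ.suc-injective (h (Fin.suc i) pi)) e

count-split : (p q : Fin n → Bool) → count p ≡ count (λ i → p i ∧ not (q i)) ℕ.+ count (λ i → p i ∧ q i)
count-split {zero} p q = refl
count-split {suc n} p q with p Fin.zero | q Fin.zero | count-split (λ i → p (Fin.suc i)) (λ i → q (Fin.suc i))
... | true | true | ih = trans (cong suc ih) (sym (ℕₚ.+-suc _ _))
... | true | false | ih = cong suc ih
... | false | true | ih = ih
... | false | false | ih = ih

iter-+ : ∀ a b (α : Perm n) i → iter (a ℕ.+ b) α i ≡ iter a α (iter b α i)
iter-+ zero b α i = refl
iter-+ (suc a) b α i = cong α (iter-+ a b α i)

iter-sucʳ : ∀ k (α : Perm n) i → iter (suc k) α i ≡ iter k α (α i)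
iter-sucʳ k α i = trans (cong (λ x → iter x α i) (ℕₚ.+-comm 1 k)) (iter-+ k 1 α i)

iter-cong : ∀ k {α β : Perm n} → α ≗ β → ∀ i → iter k α i ≡ iter k β i
iter-cong zero h i = refl
iter-cong (suc k) {α} h i = trans (cong α (iter-cong k h i)) (h _)

iter-injective : ∀ k {α : Perm n} → Injective _≡_ _≡_ α → Injective _≡_ _≡_ (iter k α)
iter-injective zero inj e = e
iter-injective (suc k) inj e = iter-injective k inj (inj e)

iter-*-period : ∀ (α : Perm n) i q₀ → iter q₀ α i ≡ i → ∀ q → iter (q ℕ.* q₀) α i ≡ i
iter-*-period α i q₀ e zero = refl
iter-*-period α i q₀ e (suc q) =
  trans (iter-+ q₀ (q ℕ.* q₀) α i) (trans (cong (iter q₀ α) (iter-*-period α i q₀ e q)) e)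

-- Pigeonhole on the n+1 points i, α i, …, αⁿ i.
iter-period : (α : Perm n) → Injective _≡_ _≡_ α → (i : Fin n) →
  ∃[ p ] suc p ≤ n × iter (suc p) α i ≡ i
iter-period {n} α inj i with Finₚ.pigeonhole (ℕₚ.n<1+n n) (λ (j : Fin (suc n)) → iter (toℕ j) α i)
... | a , b , a<b , eq = p , sp≤n , sym (iter-injective (toℕ a) inj (sym shifted))
  where
  p = toℕ b ∸ suc (toℕ a)
  b≡a+sp : toℕ b ≡ toℕ a ℕ.+ suc p
  b≡a+sp = trans (sym (ℕₚ.m+[n∸m]≡n a<b)) (sym (ℕₚ.+-suc (toℕ a) p))
  sp≤n : suc p ≤ n
  sp≤n = ℕₚ.≤-trans (ℕₚ.m≤n+m (suc p) (toℕ a))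
           (ℕₚ.≤-trans (ℕₚ.≤-reflexive (sym b≡a+sp)) (ℕₚ.≤-pred (Finₚ.toℕ<n b)))
  shifted : iter (toℕ a) α (iter (suc p) α i) ≡ iter (toℕ a) α i
  shifted = trans (sym (iter-+ (toℕ a) (suc p) α i)) (trans (cong (λ x → iter x α i) (sym b≡a+sp)) (sym eq))

iter-mod-period : ∀ (α : Perm n) i p → iter (suc p) α i ≡ i → ∀ k → ∃[ r ] r < suc p × iter k α i ≡ iter r α i
iter-mod-period α i p per zero = zero , s≤s z≤n , refl
iter-mod-period α i p per (suc k) with iter-mod-period α i p per k
... | r , r<sp , e with ℕₚ.<-cmp (suc r) (suc p)
... | tri< lt _ _ = suc r , lt , cong α e
... | tri≈ _ eq _ = zero , s≤s z≤n , trans (cong α e) (trans (cong (λ x → iter x α i) eq) per)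
... | tri> _ _ gt = ⊥-elim (ℕₚ.<-irrefl refl (ℕₚ.<-≤-trans gt r<sp))

iter-bounded : (α : Perm n) → Injective _≡_ _≡_ α → ∀ i k → ∃[ r ] r < n × iter k α i ≡ iter r α i
iter-bounded α inj i k with iter-period α inj i
... | p , sp≤n , per with iter-mod-period α i p per k
... | r , r<sp , e = r , ℕₚ.<-≤-trans r<sp sp≤n , e

SameCycle : Perm n → Fin n → Fin n → Set
SameCycle α i j = ∃[ k ] iter k α i ≡ j

sameCycle-refl : ∀ (α : Perm n) i → SameCycle α i i
sameCycle-refl α i = zero , refl

sameCycle-step : ∀ {α : Perm n} {i j} → SameCycle α i j → SameCycle α i (α j)
sameCycle-step (k , e) = suc k , cong _ e

sameCycle-trans : ∀ {α : Perm n} {i j l} → SameCycle α i j → SameCycle α j l → SameCycle α i l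
sameCycle-trans {α = α} {i} (k , e) (k' , e') = k' ℕ.+ k , trans (iter-+ k' k α i) (trans (cong (iter k' α) e) e')

sameCycle-sym : ∀ {α : Perm n} → Injective _≡_ _≡_ α → ∀ {i j} → SameCycle α i j → SameCycle α j i
sameCycle-sym {α = α} inj {i} (k , refl) with iter-period α inj i
... | p , _ , per = k ℕ.* p , trans (sym (iter-+ (k ℕ.* p) k α i))
                              (trans (cong (λ x → iter x α i) kp+k≡k*sp) (iter-*-period α i (suc p) per k))
  where
  kp+k≡k*sp : k ℕ.* p ℕ.+ k ≡ k ℕ.* suc p
  kp+k≡k*sp = trans (ℕₚ.+-comm (k ℕ.* p) k) (sym (ℕₚ.*-suc k p))

sameCycle-cong : ∀ {α β : Perm n} → α ≗ β → ∀ {i j} → SameCycle α i j → SameCycle β i j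
sameCycle-cong h {i} (k , e) = k , trans (sym (iter-cong k h i)) e

IsCycleMin : Perm n → Fin n → Set
IsCycleMin α i = ∀ j → SameCycle α i j → toℕ i ≤ toℕ j

isCycleMin⇒IsCycleMin : (α : Perm n) → Injective _≡_ _≡_ α → ∀ i → isCycleMin α i ≡ true → IsCycleMin α i
isCycleMin⇒IsCycleMin {n} α inj i h j (k , refl) with iter-bounded α inj i k
... | r , r<n , e = subst (λ x → toℕ i ≤ toℕ x) (sym e)
  (ℕₚ.≤ᵇ⇒≤ (toℕ i) _ (≡true⇒T (allB-applyUpTo⁻ n (λ x → x) (λ k → toℕ i ≤ᵇ toℕ (iter k α i)) h r r<n)))

IsCycleMin⇒isCycleMin : (α : Perm n) → ∀ i → IsCycleMin α i → isCycleMin α i ≡ true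
IsCycleMin⇒isCycleMin {n} α i h = allB-applyUpTo⁺ n (λ x → x) _ (λ k _ → T⇒≡true (ℕₚ.≤⇒≤ᵇ (h _ (k , refl))))

sameBlock⇒SameCycle : (α : Perm n) → ∀ i j → sameBlock α i j ≡ true → SameCycle α i j
sameBlock⇒SameCycle {n} α i j h with anyB-applyUpTo⁻ n (λ x → x) (λ k → iter k α i == j) h
... | k , _ , e = k , ==⇒≡ e

SameCycle⇒sameBlock : (α : Perm n) → Injective _≡_ _≡_ α → ∀ i j → SameCycle α i j → sameBlock α i j ≡ true
SameCycle⇒sameBlock {n} α inj i j (k , refl) with iter-bounded α inj i k
... | r , r<n , e = anyB-applyUpTo⁺ n (λ x → x) (λ x → iter x α i == iter k α i) r r<n
  (subst (λ x → iter r α i == x ≡ true) (sym e) (==-refl (iter r α i)))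

cycleArgmin : Perm n → Fin n → ℕ → Fin n
cycleArgmin ρ y zero = y
cycleArgmin ρ y (suc k) =
  if toℕ (iter (suc k) ρ y) ≤ᵇ toℕ (cycleArgmin ρ y k) then iter (suc k) ρ y else cycleArgmin ρ y k

cycleArgmin-sameCycle : ∀ (ρ : Perm n) y k → SameCycle ρ y (cycleArgmin ρ y k)
cycleArgmin-sameCycle ρ y zero = sameCycle-refl ρ y
cycleArgmin-sameCycle ρ y (suc k) with toℕ (iter (suc k) ρ y) ≤ᵇ toℕ (cycleArgmin ρ y k)
... | true = suc k , refl
... | false = cycleArgmin-sameCycle ρ y k

cycleArgmin-≤ : ∀ (ρ : Perm n) y k k' → k' ≤ k → toℕ (cycleArgmin ρ y k) ≤ toℕ (iter k' ρ y)
cycleArgmin-≤ ρ y zero .zero z≤n = ℕₚ.≤-refl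
cycleArgmin-≤ ρ y (suc k) k' k'≤ with toℕ (iter (suc k) ρ y) ≤ᵇ toℕ (cycleArgmin ρ y k) in e
... | true with ℕₚ.m≤n⇒m<n∨m≡n k'≤
...   | inj₁ (s≤s lt) = ℕₚ.≤-trans (ℕₚ.≤ᵇ⇒≤ _ _ (≡true⇒T e)) (cycleArgmin-≤ ρ y k k' lt)
...   | inj₂ refl = ℕₚ.≤-refl
cycleArgmin-≤ ρ y (suc k) k' k'≤ | false with ℕₚ.m≤n⇒m<n∨m≡n k'≤
...   | inj₁ (s≤s lt) = cycleArgmin-≤ ρ y k k' lt
...   | inj₂ refl = ℕₚ.<⇒≤ (ℕₚ.≰⇒> (λ le → true≢false (trans (sym (T⇒≡true (ℕₚ.≤⇒≤ᵇ le))) e)))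

cycleMin-exists : (ρ : Perm n) → Injective _≡_ _≡_ ρ → ∀ y → ∃[ j ] IsCycleMin ρ j × SameCycle ρ j y
cycleMin-exists {n} ρ inj y = j , isMin , sameCycle-sym inj (cycleArgmin-sameCycle ρ y n)
  where
  j = cycleArgmin ρ y n
  isMin : IsCycleMin ρ j
  isMin w (t , refl) with cycleArgmin-sameCycle ρ y n
  ... | k' , e with iter-bounded ρ inj y (t ℕ.+ k')
  ... | r , r<n , e₂ =
    subst (λ x → toℕ j ≤ toℕ x) (trans (sym e₂) (trans (iter-+ t k' ρ y) (cong (iter t ρ) e)))
      (cycleArgmin-≤ ρ y n r (ℕₚ.<⇒≤ r<n))

cycleMin-unique : (ρ : Perm n) → Injective _≡_ _≡_ ρ → ∀ {a b y} → IsCycleMin ρ a → IsCycleMin ρ b →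
  SameCycle ρ a y → SameCycle ρ b y → a ≡ b
cycleMin-unique ρ inj ma mb ra rb = Finₚ.toℕ-injective (ℕₚ.≤-antisym
  (ma _ (sameCycle-trans ra (sameCycle-sym inj rb)))
  (mb _ (sameCycle-trans rb (sameCycle-sym inj ra))))

numCycles-cong : {α β : Perm n} → α ≗ β → numCycles α ≡ numCycles β
numCycles-cong {n} {α} {β} h = trans (numCycles≡count α) (trans (count-cong eq) (sym (numCycles≡count β)))
  where
  eq : ∀ i → isCycleMin α i ≡ isCycleMin β i
  eq i = allB-cong (upTo n) (λ k → cong (λ x → toℕ i ≤ᵇ toℕ x) (iter-cong k h i))

addFixed : Perm n → Perm (suc n)
addFixed ρ Fin.zero = Fin.zero
addFixed ρ (Fin.suc i) = Fin.suc (ρ i)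

insertBefore : Perm n → Fin n → Perm (suc n)
insertBefore ρ y Fin.zero = Fin.suc y
insertBefore ρ y (Fin.suc i) = if ρ i == y then Fin.zero else Fin.suc (ρ i)

data InsertView (ρ : Perm n) (y : Fin n) (i : Fin n) : Set where
  hit  : ρ i ≡ y → insertBefore ρ y (Fin.suc i) ≡ Fin.zero → InsertView ρ y i
  miss : ρ i ≢ y → insertBefore ρ y (Fin.suc i) ≡ Fin.suc (ρ i) → InsertView ρ y i

insertView : ∀ (ρ : Perm n) y i → InsertView ρ y i
insertView ρ y i with ==-view (ρ i) y
... | equal e b = hit e (cong (λ c → if c then Fin.zero else Fin.suc (ρ i)) b)
... | unequal e b = miss e (cong (λ c → if c then Fin.zero else Fin.suc (ρ i)) b)

Surjective′ : Perm n → Set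
Surjective′ {n} α = ∀ (j : Fin n) → ∃[ i ] α i ≡ j

injective-resp-≗ : {α β : Perm n} → α ≗ β → Injective _≡_ _≡_ α → Injective _≡_ _≡_ β
injective-resp-≗ h inj e = inj (trans (h _) (trans e (sym (h _))))

surjective-resp-≗ : {α β : Perm n} → α ≗ β → Surjective′ α → Surjective′ β
surjective-resp-≗ h s j with s j
... | i , e = i , trans (sym (h i)) e

addFixed-cong : {ρ ρ' : Perm n} → ρ ≗ ρ' → addFixed ρ ≗ addFixed ρ'
addFixed-cong h Fin.zero = refl
addFixed-cong h (Fin.suc i) = cong Fin.suc (h i)

addFixed-injective : {ρ : Perm n} → Injective _≡_ _≡_ ρ → Injective _≡_ _≡_ (addFixed ρ)
addFixed-injective inj {Fin.zero} {Fin.zero} e = refl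
addFixed-injective inj {Fin.suc i} {Fin.suc j} e = cong Fin.suc (inj (Finₚ.suc-injective e))

addFixed-surjective : {ρ : Perm n} → Surjective′ ρ → Surjective′ (addFixed ρ)
addFixed-surjective s Fin.zero = Fin.zero , refl
addFixed-surjective s (Fin.suc j) with s j
... | i , e = Fin.suc i , cong Fin.suc e

insertBefore-injective : {ρ : Perm n} {y : Fin n} → Injective _≡_ _≡_ ρ → Injective _≡_ _≡_ (insertBefore ρ y)
insertBefore-injective inj {Fin.zero} {Fin.zero} e = refl
insertBefore-injective {ρ = ρ} {y} inj {Fin.zero} {Fin.suc j} e with insertView ρ y j
... | hit _ b = ⊥-elim (Finₚ.0≢1+n (sym (trans e b)))
... | miss h b = ⊥-elim (h (sym (Finₚ.suc-injective (trans e b))))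
insertBefore-injective {ρ = ρ} {y} inj {Fin.suc i} {Fin.zero} e with insertView ρ y i
... | hit _ b = ⊥-elim (Finₚ.0≢1+n (trans (sym b) e))
... | miss h b = ⊥-elim (h (Finₚ.suc-injective (trans (sym b) e)))
insertBefore-injective {ρ = ρ} {y} inj {Fin.suc i} {Fin.suc j} e with insertView ρ y i | insertView ρ y j
... | hit hi _ | hit hj _ = cong Fin.suc (inj (trans hi (sym hj)))
... | hit _ bi | miss _ bj = ⊥-elim (Finₚ.0≢1+n (trans (sym bi) (trans e bj)))
... | miss _ bi | hit _ bj = ⊥-elim (Finₚ.0≢1+n (sym (trans (sym bi) (trans e bj))))
... | miss _ bi | miss _ bj = cong Fin.suc (inj (Finₚ.suc-injective (trans (sym bi) (trans e bj))))

insertBefore-surjective : {ρ : Perm n} {y : Fin n} → Surjective′ ρ → Surjective′ (insertBefore ρ y)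
insertBefore-surjective {ρ = ρ} {y} s Fin.zero with s y
... | i , e with insertView ρ y i
... | hit _ b = Fin.suc i , b
... | miss h _ = ⊥-elim (h e)
insertBefore-surjective {ρ = ρ} {y} s (Fin.suc w) with ==-view w y
... | equal e _ = Fin.zero , cong Fin.suc (sym e)
... | unequal ne _ with s w
... | i , e with insertView ρ y i
... | hit h _ = ⊥-elim (ne (trans (sym e) h))
... | miss _ b = Fin.suc i , trans b (cong Fin.suc e)

iter-addFixed-suc : ∀ k (ρ : Perm n) i → iter k (addFixed ρ) (Fin.suc i) ≡ Fin.suc (iter k ρ i)
iter-addFixed-suc zero ρ i = refl
iter-addFixed-suc (suc k) ρ i rewrite iter-addFixed-suc k ρ i = refl

iter-addFixed-zero : ∀ k (ρ : Perm n) → iter k (addFixed ρ) Fin.zero ≡ Fin.zero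
iter-addFixed-zero zero ρ = refl
iter-addFixed-zero (suc k) ρ rewrite iter-addFixed-zero k ρ = refl

sameCycle-addFixed⁺ : ∀ {ρ : Perm n} {i j} → SameCycle ρ i j → SameCycle (addFixed ρ) (Fin.suc i) (Fin.suc j)
sameCycle-addFixed⁺ {ρ = ρ} {i} (k , e) = k , trans (iter-addFixed-suc k ρ i) (cong Fin.suc e)

sameCycle-addFixed-suc⁻ : ∀ {ρ : Perm n} {i w} → SameCycle (addFixed ρ) (Fin.suc i) w →
  ∃[ j ] w ≡ Fin.suc j × SameCycle ρ i j
sameCycle-addFixed-suc⁻ {ρ = ρ} {i} (k , e) = iter k ρ i , trans (sym e) (iter-addFixed-suc k ρ i) , k , refl

sameCycle-addFixed-zero⁻ : ∀ {ρ : Perm n} {w} → SameCycle (addFixed ρ) Fin.zero w → w ≡ Fin.zero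
sameCycle-addFixed-zero⁻ {ρ = ρ} (k , e) = trans (sym e) (iter-addFixed-zero k ρ)

module InsertBeforeCycles (ρ : Perm n) (y : Fin n) where
  private
    ρ⁺ = insertBefore ρ y

    sameCycle-suc-step : ∀ x → SameCycle ρ⁺ (Fin.suc x) (Fin.suc (ρ x))
    sameCycle-suc-step x with insertView ρ y x
    ... | hit h b = 2 , trans (cong ρ⁺ b) (cong Fin.suc (sym h))
    ... | miss h b = 1 , b

  sameCycle-suc⁺ : ∀ {i j} → SameCycle ρ i j → SameCycle ρ⁺ (Fin.suc i) (Fin.suc j)
  sameCycle-suc⁺ (zero , refl) = sameCycle-refl ρ⁺ _
  sameCycle-suc⁺ {i} (suc k , refl) = sameCycle-trans (sameCycle-suc⁺ (k , refl)) (sameCycle-suc-step (iter k ρ i))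

  sameCycle-suc-zero⁺ : Injective _≡_ _≡_ ρ → ∀ {i} → SameCycle ρ i y → SameCycle ρ⁺ (Fin.suc i) Fin.zero
  sameCycle-suc-zero⁺ inj {i} (suc k , e) with insertView ρ y (iter k ρ i)
  ... | hit h b = sameCycle-trans (sameCycle-suc⁺ (k , refl)) (1 , b)
  ... | miss h b = ⊥-elim (h e)
  sameCycle-suc-zero⁺ inj {i} (zero , refl) with iter-period ρ inj i
  ... | p , _ , per with insertView ρ i (iter p ρ i)
  ... | hit h b = sameCycle-trans (sameCycle-suc⁺ (p , refl)) (1 , b)
  ... | miss h b = ⊥-elim (h per)

  SucOrbit : Fin n → Fin (suc n) → Set
  SucOrbit i w = (∃[ j ] w ≡ Fin.suc j × SameCycle ρ i j) ⊎ (w ≡ Fin.zero × SameCycle ρ i y)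

  private
    sucOrbit-step : ∀ {i w} → SucOrbit i w → SucOrbit i (ρ⁺ w)
    sucOrbit-step (inj₂ (refl , r)) = inj₁ (y , refl , r)
    sucOrbit-step {i} (inj₁ (j , refl , r)) with insertView ρ y j
    ... | hit h b = inj₂ (b , subst (SameCycle ρ i) h (sameCycle-step r))
    ... | miss h b = inj₁ (ρ j , b , sameCycle-step r)

  sameCycle-suc⁻ : ∀ {i w} → SameCycle ρ⁺ (Fin.suc i) w → SucOrbit i w
  sameCycle-suc⁻ {i} (zero , refl) = inj₁ (i , refl , sameCycle-refl ρ i)
  sameCycle-suc⁻ {i} (suc k , refl) = sucOrbit-step (sameCycle-suc⁻ (k , refl))

  sameCycle-zero⁺ : ∀ {j} → SameCycle ρ y j → SameCycle ρ⁺ Fin.zero (Fin.suc j)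
  sameCycle-zero⁺ r = sameCycle-trans (1 , refl) (sameCycle-suc⁺ r)

  sameCycle-zero⁻ : ∀ {w} → SameCycle ρ⁺ Fin.zero w → w ≡ Fin.zero ⊎ ∃[ j ] w ≡ Fin.suc j × SameCycle ρ y j
  sameCycle-zero⁻ (zero , e) = inj₁ (sym e)
  sameCycle-zero⁻ (suc k , e) with sameCycle-suc⁻ {y} (k , trans (sym (iter-sucʳ k ρ⁺ Fin.zero)) e)
  ... | inj₁ p = inj₂ p
  ... | inj₂ (e' , _) = inj₁ e'

isCycleMin-zero : (α : Perm (suc n)) → isCycleMin α Fin.zero ≡ true
isCycleMin-zero α = IsCycleMin⇒isCycleMin α Fin.zero (λ _ _ → z≤n)

isCycleMin-addFixed-suc : (ρ : Perm n) → Injective _≡_ _≡_ ρ → ∀ i → isCycleMin (addFixed ρ) (Fin.suc i) ≡ isCycleMin ρ i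
isCycleMin-addFixed-suc ρ inj i = ≡true-ext
  (λ h → IsCycleMin⇒isCycleMin ρ i λ j r →
    ℕₚ.≤-pred (isCycleMin⇒IsCycleMin (addFixed ρ) (addFixed-injective inj) (Fin.suc i) h (Fin.suc j) (sameCycle-addFixed⁺ r)))
  (λ h → IsCycleMin⇒isCycleMin (addFixed ρ) (Fin.suc i) λ w r →
    bound (sameCycle-addFixed-suc⁻ r) (isCycleMin⇒IsCycleMin ρ inj i h))
  where
  bound : ∀ {w} → ∃[ j ] w ≡ Fin.suc j × SameCycle ρ i j → IsCycleMin ρ i → toℕ (Fin.suc i) ≤ toℕ w
  bound (j , refl , r) isMin = s≤s (isMin j r)

numCycles-addFixed : (ρ : Perm n) → Injective _≡_ _≡_ ρ → numCycles (addFixed ρ) ≡ suc (numCycles ρ)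
numCycles-addFixed ρ inj = begin
  numCycles (addFixed ρ)                                  ≡⟨ numCycles≡count (addFixed ρ) ⟩
  count (isCycleMin (addFixed ρ))                         ≡⟨ count-suc (isCycleMin (addFixed ρ)) (isCycleMin-zero (addFixed ρ)) ⟩
  suc (count (λ i → isCycleMin (addFixed ρ) (Fin.suc i))) ≡⟨ cong suc (count-cong (isCycleMin-addFixed-suc ρ inj)) ⟩
  suc (count (isCycleMin ρ))                              ≡⟨ cong suc (numCycles≡count ρ) ⟨
  suc (numCycles ρ)                                       ∎
  where open ≡-Reasoning

-- The old points whose cycle now contains 0 lose their cycle-minimum status,
-- while 0 becomes a new cycle minimum.
isCycleMin-insertBefore-suc : ∀ (ρ : Perm n) y → Injective _≡_ _≡_ ρ → ∀ i →
  isCycleMin (insertBefore ρ y) (Fin.suc i) ≡ isCycleMin ρ i ∧ not (sameBlock ρ i y)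
isCycleMin-insertBefore-suc ρ y inj i = ≡true-ext to from
  where
  open InsertBeforeCycles ρ y
  to : isCycleMin (insertBefore ρ y) (Fin.suc i) ≡ true → isCycleMin ρ i ∧ not (sameBlock ρ i y) ≡ true
  to h = ∧≡true⁺ (IsCycleMin⇒isCycleMin ρ i (λ j r → ℕₚ.≤-pred (isMin (Fin.suc j) (sameCycle-suc⁺ r))))
                 (≡false⇒not≡true (≢true⇒≡false λ sb →
                   ℕₚ.n≮0 (isMin Fin.zero (sameCycle-suc-zero⁺ inj (sameBlock⇒SameCycle ρ i y sb)))))
    where
    isMin = isCycleMin⇒IsCycleMin (insertBefore ρ y) (insertBefore-injective inj) (Fin.suc i) h
  from : isCycleMin ρ i ∧ not (sameBlock ρ i y) ≡ true → isCycleMin (insertBefore ρ y) (Fin.suc i) ≡ true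
  from h = IsCycleMin⇒isCycleMin (insertBefore ρ y) (Fin.suc i) λ w r → bound (sameCycle-suc⁻ r)
    where
    isMin = isCycleMin⇒IsCycleMin ρ inj i (proj₁ (∧≡true⁻ h))
    apart : ¬ SameCycle ρ i y
    apart r with trans (sym (SameCycle⇒sameBlock ρ inj i y r)) (not≡true⇒≡false (proj₂ (∧≡true⁻ {isCycleMin ρ i} h)))
    ... | ()
    bound : ∀ {w} → SucOrbit i w → toℕ (Fin.suc i) ≤ toℕ w
    bound (inj₁ (j , refl , r)) = s≤s (isMin j r)
    bound (inj₂ (_ , r)) = ⊥-elim (apart r)

count-cycleMin-sameBlock : ∀ (ρ : Perm n) y → Injective _≡_ _≡_ ρ → count (λ i → isCycleMin ρ i ∧ sameBlock ρ i y) ≡ 1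
count-cycleMin-sameBlock ρ y inj with cycleMin-exists ρ inj y
... | j , isMin , r = count-unique _ j
  (λ i h → cycleMin-unique ρ inj (isCycleMin⇒IsCycleMin ρ inj i (proj₁ (∧≡true⁻ h))) isMin
             (sameBlock⇒SameCycle ρ i y (proj₂ (∧≡true⁻ {isCycleMin ρ i} h))) r)
  (∧≡true⁺ (IsCycleMin⇒isCycleMin ρ j isMin) (SameCycle⇒sameBlock ρ inj j y r))

numCycles-insertBefore : ∀ (ρ : Perm n) y → Injective _≡_ _≡_ ρ → numCycles (insertBefore ρ y) ≡ numCycles ρ
numCycles-insertBefore {n} ρ y inj = begin
  numCycles (insertBefore ρ y)
    ≡⟨ numCycles≡count (insertBefore ρ y) ⟩
  count (isCycleMin (insertBefore ρ y))
    ≡⟨ count-suc (isCycleMin (insertBefore ρ y)) (isCycleMin-zero (insertBefore ρ y)) ⟩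
  suc (count (λ i → isCycleMin (insertBefore ρ y) (Fin.suc i)))
    ≡⟨ cong suc (count-cong (isCycleMin-insertBefore-suc ρ y inj)) ⟩
  suc (count apart)
    ≡⟨ ℕₚ.+-comm 1 _ ⟩
  count apart ℕ.+ 1
    ≡⟨ cong (count apart ℕ.+_) (count-cycleMin-sameBlock ρ y inj) ⟨
  count apart ℕ.+ count (λ i → isCycleMin ρ i ∧ sameBlock ρ i y)
    ≡⟨ count-split (isCycleMin ρ) (λ i → sameBlock ρ i y) ⟨
  count (isCycleMin ρ)
    ≡⟨ numCycles≡count ρ ⟨
  numCycles ρ
    ∎
  where
  open ≡-Reasoning
  apart : Fin n → Bool
  apart i = isCycleMin ρ i ∧ not (sameBlock ρ i y)

toℕ-finOf : ∀ k → k < suc m → toℕ (finOf {m} k) ≡ k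
toℕ-finOf {m} k lt = trans (Finₚ.toℕ-fromℕ< (m%n<n k (suc m))) (m<n⇒m%n≡m lt)

γ-view : (j : Fin (suc m)) → (toℕ j ≡ m × γ j ≡ Fin.zero) ⊎ (toℕ j < m × toℕ (γ j) ≡ suc (toℕ j))
γ-view {m} j with ℕₚ.m≤n⇒m<n∨m≡n (ℕₚ.≤-pred (Finₚ.toℕ<n j))
... | inj₁ lt = inj₂ (lt , toℕ-finOf (suc (toℕ j)) (s≤s lt))
... | inj₂ eq = inj₁ (eq , Finₚ.toℕ-injective (trans (Finₚ.toℕ-fromℕ< (m%n<n (suc (toℕ j)) (suc m)))
                          (trans (cong (λ x → suc x % suc m) eq) (n%n≡0 (suc m)))))

γ-suc : γ {suc m} ≗ insertBefore (γ {m}) Fin.zero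
γ-suc {m} Fin.zero = Finₚ.toℕ-injective (toℕ-finOf {suc m} 1 (s≤s (s≤s z≤n)))
γ-suc {m} (Fin.suc j) with γ-view j | insertView (γ {m}) Fin.zero j
... | inj₁ (e , g) | hit _ b = Finₚ.toℕ-injective (trans (Finₚ.toℕ-fromℕ< (m%n<n (suc (suc (toℕ j))) (suc (suc m))))
                          (trans (cong (λ x → suc (suc x) % suc (suc m)) e) (trans (n%n≡0 (suc (suc m))) (cong toℕ (sym b)))))
... | inj₁ (e , g) | miss h _ = ⊥-elim (h g)
... | inj₂ (lt , g) | hit h _ = ⊥-elim (ℕₚ.0≢1+n (trans (sym (cong toℕ h)) g))
... | inj₂ (lt , g) | miss _ b = Finₚ.toℕ-injective
  (trans (toℕ-finOf (suc (suc (toℕ j))) (s≤s (s≤s lt))) (sym (trans (cong toℕ b) (cong suc g))))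

γ-injective : Injective _≡_ _≡_ (γ {m})
γ-injective {zero} {Fin.zero} {Fin.zero} _ = refl
γ-injective {suc m} = injective-resp-≗ (λ i → sym (γ-suc i)) (insertBefore-injective (γ-injective {m}))

γ-surjective : Surjective′ (γ {m})
γ-surjective {zero} Fin.zero = Fin.zero , refl
γ-surjective {suc m} = surjective-resp-≗ (λ i → sym (γ-suc i)) (insertBefore-surjective (γ-surjective {m}))

γ-last : γ {m} (fromℕ m) ≡ Fin.zero
γ-last {m} with γ-view (fromℕ m)
... | inj₁ (_ , g) = g
... | inj₂ (lt , _) = ⊥-elim (ℕₚ.<-irrefl (Finₚ.toℕ-fromℕ m) lt)

findL-tabulate : ∀ (f : Fin n → Fin m) (p : Fin m → Bool) d i → p (f i) ≡ true → p (findL (tabulate f) p d) ≡ true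
findL-tabulate {n = suc n} f p d i h with p (f Fin.zero) in e | i
... | true | _ = e
... | false | Fin.zero = ⊥-elim (true≢false (trans (sym h) e))
... | false | Fin.suc i' = findL-tabulate (λ x → f (Fin.suc x)) p d i' h

inv-inverseˡ : (α : Perm n) → Injective _≡_ _≡_ α → ∀ i → inv α (α i) ≡ i
inv-inverseˡ α inj i = inj (==⇒≡ (findL-tabulate (λ x → x) (λ x → α x == α i) (α i) i (==-refl (α i))))

inv-inverseʳ : (α : Perm n) → Surjective′ α → ∀ j → α (inv α j) ≡ j
inv-inverseʳ α s j with s j
... | i , e = ==⇒≡ (findL-tabulate (λ x → x) (λ x → α x == j) j i (subst (λ z → α i == z ≡ true) e (==-refl (α i))))

-- Each lemma extends a factorisation a ∘ s ≗ d by the new point 0.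

module _ {a s d : Perm n} (a∘s≗d : ∀ i → a (s i) ≡ d i) where

  addFixed-∘-insertBefore : Injective _≡_ _≡_ a → ∀ {z y} → a z ≡ y →
    ∀ i → addFixed a (insertBefore s z i) ≡ insertBefore d y i
  addFixed-∘-insertBefore inj e Fin.zero = cong Fin.suc e
  addFixed-∘-insertBefore inj {z} {y} e (Fin.suc j) with insertView s z j | insertView d y j
  ... | hit _ b₁ | hit _ b₂ = trans (cong (addFixed a) b₁) (sym b₂)
  ... | hit h₁ _ | miss h₂ _ = ⊥-elim (h₂ (trans (sym (a∘s≗d j)) (trans (cong a h₁) e)))
  ... | miss h₁ _ | hit h₂ _ = ⊥-elim (h₁ (inj (trans (a∘s≗d j) (trans h₂ (sym e)))))
  ... | miss _ b₁ | miss _ b₂ = trans (cong (addFixed a) b₁) (trans (cong Fin.suc (a∘s≗d j)) (sym b₂))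

  insertBefore-∘-insertBefore : Injective _≡_ _≡_ a → ∀ {z y} → a z ≡ y →
    ∀ i → insertBefore a y (insertBefore s z i) ≡ addFixed d i
  insertBefore-∘-insertBefore inj {z} {y} e Fin.zero with insertView a y z
  ... | hit _ b = b
  ... | miss h _ = ⊥-elim (h e)
  insertBefore-∘-insertBefore inj {z} {y} e (Fin.suc j) with insertView s z j
  ... | hit h₁ b₁ = trans (cong (insertBefore a y) b₁) (cong Fin.suc (trans (sym e) (trans (cong a (sym h₁)) (a∘s≗d j))))
  ... | miss h₁ b₁ with insertView a y (s j)
  ...   | hit h₂ _ = ⊥-elim (h₁ (inj (trans h₂ (sym e))))
  ...   | miss _ b₂ = trans (cong (insertBefore a y) b₁) (trans b₂ (cong Fin.suc (a∘s≗d j)))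

  insertBefore-∘-addFixed : ∀ {y} i → insertBefore a y (addFixed s i) ≡ insertBefore d y i
  insertBefore-∘-addFixed Fin.zero = refl
  insertBefore-∘-addFixed {y} (Fin.suc j) = cong (λ x → if x == y then Fin.zero else Fin.suc x) (a∘s≗d j)

  addFixed-∘-addFixed : ∀ i → addFixed a (addFixed s i) ≡ addFixed d i
  addFixed-∘-addFixed Fin.zero = refl
  addFixed-∘-addFixed (Fin.suc j) = cong Fin.suc (a∘s≗d j)

blockStart≤ : (c : Vec Bool m) → ∀ p → blockStart c p ≤ p
blockStart≤ c zero = z≤n
blockStart≤ c (suc p) with cutAt c p
... | true = ℕₚ.≤-refl
... | false = ℕₚ.m≤n⇒m≤1+n (blockStart≤ c p)

cutAt≡false⇒< : (c : Vec Bool m) → ∀ p → cutAt c p ≡ false → p < m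
cutAt≡false⇒< [] p ()
cutAt≡false⇒< (b ∷ c) zero e = s≤s z≤n
cutAt≡false⇒< (b ∷ c) (suc p) e = s≤s (cutAt≡false⇒< c p e)

toℕ-intPerm : (c : Vec Bool m) (i : Fin (suc m)) →
  toℕ (intPerm c i) ≡ (if cutAt c (toℕ i) then blockStart c (toℕ i) else suc (toℕ i))
toℕ-intPerm c i with cutAt c (toℕ i) in e
... | true = toℕ-finOf (blockStart c (toℕ i)) (s≤s (ℕₚ.≤-trans (blockStart≤ c (toℕ i)) (ℕₚ.≤-pred (Finₚ.toℕ<n i))))
... | false = toℕ-finOf (suc (toℕ i)) (s≤s (cutAt≡false⇒< c (toℕ i) e))

shiftedStart : Bool → ℕ → ℕ
shiftedStart b zero = if b then 1 else 0
shiftedStart b (suc s) = suc (suc s)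

blockStart-∷ : ∀ b (c : Vec Bool m) p → blockStart (b ∷ c) (suc p) ≡ shiftedStart b (blockStart c p)
blockStart-∷ true c zero = refl
blockStart-∷ false c zero = refl
blockStart-∷ b c (suc p) with cutAt c p
... | true = refl
... | false = blockStart-∷ b c p

-- A cut after the new first point makes it a singleton block; no cut joins it to the next block.
prependCut : Bool → Perm (suc n) → Perm (suc (suc n))
prependCut true ρ = addFixed ρ
prependCut false ρ = insertBefore ρ Fin.zero

prependCut-injective : ∀ b {ρ : Perm (suc n)} → Injective _≡_ _≡_ ρ → Injective _≡_ _≡_ (prependCut b ρ)
prependCut-injective true = addFixed-injective
prependCut-injective false = insertBefore-injective

prependCut-surjective : ∀ b {ρ : Perm (suc n)} → Surjective′ ρ → Surjective′ (prependCut b ρ)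
prependCut-surjective true = addFixed-surjective
prependCut-surjective false = insertBefore-surjective

intPerm-∷ : ∀ b (c : Vec Bool m) → intPerm (b ∷ c) ≗ prependCut b (intPerm c)
intPerm-∷ true c Fin.zero = Finₚ.toℕ-injective (toℕ-intPerm (true ∷ c) Fin.zero)
intPerm-∷ false c Fin.zero = Finₚ.toℕ-injective (toℕ-intPerm (false ∷ c) Fin.zero)
intPerm-∷ b c (Fin.suc j) = Finₚ.toℕ-injective (trans (toℕ-intPerm (b ∷ c) (Fin.suc j)) (shifted b (toℕ-intPerm c j)))
  where
  p = toℕ j
  ρ = intPerm c
  shifted : ∀ b → toℕ (ρ j) ≡ (if cutAt c p then blockStart c p else suc p) →
    (if cutAt c p then blockStart (b ∷ c) (suc p) else suc (suc p)) ≡ toℕ (prependCut b ρ (Fin.suc j))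
  shifted true e with cutAt c p
  ... | false = cong suc (sym e)
  ... | true = trans (blockStart-∷ true c p) (trans (start (blockStart c p)) (cong suc (sym e)))
    where
    start : ∀ s → shiftedStart true s ≡ suc s
    start zero = refl
    start (suc s) = refl
  shifted false e with insertView ρ Fin.zero j
  shifted false e | hit h b with cutAt c p
  ... | false = ⊥-elim (ℕₚ.0≢1+n (trans (sym (cong toℕ h)) e))
  ... | true = trans (blockStart-∷ false c p)
                 (trans (cong (shiftedStart false) (trans (sym e) (cong toℕ h))) (cong toℕ (sym b)))
  shifted false e | miss h b with cutAt c p
  ... | false = trans (cong suc (sym e)) (cong toℕ (sym b))
  ... | true = trans (blockStart-∷ false c p)
                 (trans (start (blockStart c p) (λ z → h (Finₚ.toℕ-injective (trans e z))))
                   (trans (cong suc (sym e)) (cong toℕ (sym b))))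
    where
    start : ∀ s → s ≢ 0 → shiftedStart false s ≡ suc s
    start zero ne = ⊥-elim (ne refl)
    start (suc s) _ = refl

intPerm-injective : (c : Vec Bool m) → Injective _≡_ _≡_ (intPerm c)
intPerm-injective [] {Fin.zero} {Fin.zero} _ = refl
intPerm-injective (b ∷ c) = injective-resp-≗ (λ i → sym (intPerm-∷ b c i)) (prependCut-injective b (intPerm-injective c))

intPerm-surjective : (c : Vec Bool m) → Surjective′ (intPerm c)
intPerm-surjective [] Fin.zero = Fin.zero , refl
intPerm-surjective (b ∷ c) = surjective-resp-≗ (λ i → sym (intPerm-∷ b c i)) (prependCut-surjective b (intPerm-surjective c))

joins : Vec Bool m → ℕ
joins [] = 0
joins (true ∷ c) = joins c
joins (false ∷ c) = suc (joins c)

hamming : Vec Bool m → Vec Bool m → ℕ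
hamming [] [] = 0
hamming (b ∷ c) (b' ∷ d) = (if b xor b' then 1 else 0) ℕ.+ hamming c d

disjoint : Vec Bool m → Vec Bool m → Bool
disjoint [] [] = true
disjoint (b ∷ c) (b' ∷ d) = not (b ∧ b') ∧ disjoint c d

_⊆ᵇ_ : Vec Bool m → Vec Bool m → Bool
[] ⊆ᵇ [] = true
(b ∷ c) ⊆ᵇ (b' ∷ d) = (not b ∨ b') ∧ (c ⊆ᵇ d)

noCuts : ∀ m → Vec Bool m
noCuts zero = []
noCuts (suc m) = false ∷ noCuts m

‖‖≡ : ∀ (σ : Perm n) k → numCycles σ ℕ.+ k ≡ n → ‖ σ ‖ ≡ k
‖‖≡ σ k e = trans (cong (_∸ numCycles σ) (sym e)) (ℕₚ.m+n∸m≡n (numCycles σ) k)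

numCycles-intPerm : (c : Vec Bool m) → numCycles (intPerm c) ℕ.+ joins c ≡ suc m
numCycles-intPerm [] = refl
numCycles-intPerm (true ∷ c) = trans
  (cong (ℕ._+ joins c) (trans (numCycles-cong (intPerm-∷ true c)) (numCycles-addFixed (intPerm c) (intPerm-injective c))))
  (cong suc (numCycles-intPerm c))
numCycles-intPerm (false ∷ c) = trans
  (cong (ℕ._+ suc (joins c)) (trans (numCycles-cong (intPerm-∷ false c))
                                     (numCycles-insertBefore (intPerm c) Fin.zero (intPerm-injective c))))
  (trans (ℕₚ.+-suc _ (joins c)) (cong suc (numCycles-intPerm c)))

‖intPerm‖ : (c : Vec Bool m) → ‖ intPerm c ‖ ≡ joins c
‖intPerm‖ c = ‖‖≡ _ _ (numCycles-intPerm c)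

record Transition (α β : Perm n) (k : ℕ) : Set where
  field
    σ           : Perm n
    σ-injective : Injective _≡_ _≡_ σ
    α∘σ≗β       : ∀ i → α (σ i) ≡ β i
    numCycles-σ : numCycles σ ℕ.+ k ≡ n

open Transition

‖inv·‖≡ : {α β : Perm n} {k : ℕ} → Injective _≡_ _≡_ α → Transition α β k → ‖ inv α · β ‖ ≡ k
‖inv·‖≡ {α = α} {β} {k} inj τ = ‖‖≡ _ _ (trans (cong (ℕ._+ k) (numCycles-cong inv·≗σ)) (numCycles-σ τ))
  where
  inv·≗σ : ∀ i → inv α (β i) ≡ σ τ i
  inv·≗σ i = trans (cong (inv α) (sym (α∘σ≗β τ i))) (inv-inverseˡ α inj (σ τ i))

transition-resp-≗ : {α α' β β' : Perm n} {k : ℕ} → α ≗ α' → β ≗ β' → Transition α β k → Transition α' β' k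
transition-resp-≗ α≗α' β≗β' τ = record
  { σ = σ τ
  ; σ-injective = σ-injective τ
  ; α∘σ≗β = λ i → trans (sym (α≗α' (σ τ i))) (trans (α∘σ≗β τ i) (β≗β' i))
  ; numCycles-σ = numCycles-σ τ
  }

transition-addFixed : {α β : Perm n} {α' β' : Perm (suc n)} {k : ℕ} (τ : Transition α β k) →
  (∀ i → α' (addFixed (σ τ) i) ≡ β' i) → Transition α' β' k
transition-addFixed {k = k} τ rel = record
  { σ = addFixed (σ τ)
  ; σ-injective = addFixed-injective (σ-injective τ)
  ; α∘σ≗β = rel
  ; numCycles-σ = trans (cong (ℕ._+ k) (numCycles-addFixed (σ τ) (σ-injective τ))) (cong suc (numCycles-σ τ))
  }

transition-insertBefore : {α β : Perm n} {α' β' : Perm (suc n)} {k : ℕ} (τ : Transition α β k) (z : Fin n) →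
  (∀ i → α' (insertBefore (σ τ) z i) ≡ β' i) → Transition α' β' (suc k)
transition-insertBefore {k = k} τ z rel = record
  { σ = insertBefore (σ τ) z
  ; σ-injective = insertBefore-injective (σ-injective τ)
  ; α∘σ≗β = rel
  ; numCycles-σ = trans (cong (ℕ._+ suc k) (numCycles-insertBefore (σ τ) z (σ-injective τ)))
                    (trans (ℕₚ.+-suc _ _) (cong suc (numCycles-σ τ)))
  }

intPerm-transition : (c d : Vec Bool m) → Transition (intPerm c) (intPerm d) (hamming c d)
intPerm-transition [] [] = record { σ = λ i → i ; σ-injective = λ e → e ; α∘σ≗β = λ i → refl ; numCycles-σ = refl }
intPerm-transition (b ∷ c) (b' ∷ d) =
  transition-resp-≗ (λ i → sym (intPerm-∷ b c i)) (λ i → sym (intPerm-∷ b' d i)) (step b b')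
  where
  τ = intPerm-transition c d
  z = proj₁ (intPerm-surjective c Fin.zero)
  z↦0 = proj₂ (intPerm-surjective c Fin.zero)
  step : ∀ b b' → Transition (prependCut b (intPerm c)) (prependCut b' (intPerm d)) (hamming (b ∷ c) (b' ∷ d))
  step true true = transition-addFixed τ (addFixed-∘-addFixed (α∘σ≗β τ))
  step false false = transition-addFixed τ (insertBefore-∘-addFixed (α∘σ≗β τ))
  step true false = transition-insertBefore τ z (addFixed-∘-insertBefore (α∘σ≗β τ) (intPerm-injective c) z↦0)
  step false true = transition-insertBefore τ z (insertBefore-∘-insertBefore (α∘σ≗β τ) (intPerm-injective c) z↦0)

‖intPerm⁻¹·intPerm‖ : (c d : Vec Bool m) → ‖ inv (intPerm c) · intPerm d ‖ ≡ hamming c d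
‖intPerm⁻¹·intPerm‖ c d = ‖inv·‖≡ (intPerm-injective c) (intPerm-transition c d)

intPerm∘krIntPerm : (c : Vec Bool m) → ∀ i → intPerm c (krIntPerm c i) ≡ γ i
intPerm∘krIntPerm c i = inv-inverseʳ (intPerm c) (intPerm-surjective c) (γ i)

krIntPerm-unique : (c : Vec Bool m) {ρ : Perm (suc m)} → (∀ i → intPerm c (ρ i) ≡ γ i) → krIntPerm c ≗ ρ
krIntPerm-unique c {ρ} h i = trans (cong (inv (intPerm c)) (sym (h i))) (inv-inverseˡ (intPerm c) (intPerm-injective c) (ρ i))

krIntPerm-injective : (c : Vec Bool m) → Injective _≡_ _≡_ (krIntPerm c)
krIntPerm-injective c {i} {j} e =
  γ-injective (trans (sym (intPerm∘krIntPerm c i)) (trans (cong (intPerm c) e) (intPerm∘krIntPerm c j)))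

krIntPerm-surjective : (c : Vec Bool m) → Surjective′ (krIntPerm c)
krIntPerm-surjective c t with γ-surjective (intPerm c t)
... | i , e = i , trans (cong (inv (intPerm c)) e) (inv-inverseˡ (intPerm c) (intPerm-injective c) t)

prependKrCut : Bool → Perm (suc n) → Perm (suc (suc n))
prependKrCut false κ = addFixed κ
prependKrCut true κ = insertBefore κ (κ (fromℕ _))

krIntPerm-∷ : ∀ b (c : Vec Bool m) → krIntPerm (b ∷ c) ≗ prependKrCut b (krIntPerm c)
krIntPerm-∷ b c = krIntPerm-unique (b ∷ c) (λ i → trans (intPerm-∷ b c _) (trans (step b i) (sym (γ-suc i))))
  where
  step : ∀ b i → prependCut b (intPerm c) (prependKrCut b (krIntPerm c) i) ≡ insertBefore γ Fin.zero i
  step false = insertBefore-∘-addFixed (intPerm∘krIntPerm c)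
  step true = addFixed-∘-insertBefore (intPerm∘krIntPerm c) (intPerm-injective c)
                (trans (intPerm∘krIntPerm c (fromℕ _)) γ-last)

krIntPerm-transition : (c d : Vec Bool m) → disjoint c d ≡ true →
  Transition (krIntPerm c) (krIntPerm d) (hamming c d)
krIntPerm-transition [] [] _ = record
  { σ = λ i → i ; σ-injective = λ e → e ; α∘σ≗β = λ i → Fin1-≡ _ _ ; numCycles-σ = refl }
krIntPerm-transition (b ∷ c) (b' ∷ d) c⊥d =
  transition-resp-≗ (λ i → sym (krIntPerm-∷ b c i)) (λ i → sym (krIntPerm-∷ b' d i)) (step b b' c⊥d)
  where
  τ = krIntPerm-transition c d (proj₂ (∧≡true⁻ {not (b ∧ b')} c⊥d))
  step : ∀ b b' → not (b ∧ b') ∧ disjoint c d ≡ true →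
    Transition (prependKrCut b (krIntPerm c)) (prependKrCut b' (krIntPerm d)) (hamming (b ∷ c) (b' ∷ d))
  step true true ()
  step false false _ = transition-addFixed τ (addFixed-∘-addFixed (α∘σ≗β τ))
  step true false _ =
    transition-insertBefore τ (fromℕ _) (insertBefore-∘-insertBefore (α∘σ≗β τ) (krIntPerm-injective c) refl)
  step false true _ =
    transition-insertBefore τ (σ τ (fromℕ _))
      (addFixed-∘-insertBefore (α∘σ≗β τ) (krIntPerm-injective c) (α∘σ≗β τ (fromℕ _)))

‖krIntPerm⁻¹·krIntPerm‖ : (c d : Vec Bool m) → disjoint c d ≡ true → ‖ inv (krIntPerm c) · krIntPerm d ‖ ≡ hamming c d
‖krIntPerm⁻¹·krIntPerm‖ c d c⊥d = ‖inv·‖≡ (krIntPerm-injective c) (krIntPerm-transition c d c⊥d)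

insertBefore₀-intertwines-addFixed : {a s : Perm (suc n)} {p : Perm n} → (∀ j → a (s j) ≡ addFixed p (a j)) →
  ∀ i → insertBefore a Fin.zero (addFixed s i) ≡ addFixed (addFixed p) (insertBefore a Fin.zero i)
insertBefore₀-intertwines-addFixed rel Fin.zero = refl
insertBefore₀-intertwines-addFixed {a = a} {s} {p} rel (Fin.suc j) with insertView a Fin.zero (s j) | insertView a Fin.zero j
... | hit _ b₁ | hit _ b₂ = trans b₁ (sym (cong (addFixed (addFixed p)) b₂))
... | hit h₁ _ | miss h₂ _ = ⊥-elim (h₂ (addFixed≡zero (trans (sym (rel j)) h₁)))
  where
  addFixed≡zero : ∀ {w} → addFixed p w ≡ Fin.zero → w ≡ Fin.zero
  addFixed≡zero {Fin.zero} _ = refl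
... | miss h₁ _ | hit h₂ _ = ⊥-elim (h₁ (trans (rel j) (cong (addFixed p) h₂)))
... | miss _ b₁ | miss _ b₂ = trans b₁ (trans (cong Fin.suc (rel j)) (sym (cong (addFixed (addFixed p)) b₂)))

insertBefore₀-intertwines-insertBefore₀ : {a s : Perm (suc (suc n))} {p : Perm (suc n)} →
  Injective _≡_ _≡_ a → a Fin.zero ≡ Fin.suc Fin.zero → (∀ j → a (s j) ≡ addFixed p (a j)) →
  ∀ i → insertBefore a Fin.zero (insertBefore s Fin.zero i) ≡ addFixed (insertBefore p Fin.zero) (insertBefore a Fin.zero i)
insertBefore₀-intertwines-insertBefore₀ {a = a} inj a0 rel Fin.zero with insertView a Fin.zero Fin.zero
... | hit h _ = ⊥-elim (Finₚ.0≢1+n (trans (sym h) a0))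
... | miss _ b = trans b (cong Fin.suc a0)
insertBefore₀-intertwines-insertBefore₀ {a = a} {s} {p} inj a0 rel (Fin.suc j)
  with insertView s Fin.zero j | insertView a Fin.zero j
... | vs | hit ha ba = trans (lhs vs) (sym (cong (addFixed (insertBefore p Fin.zero)) ba))
  where
  asj : a (s j) ≡ Fin.zero
  asj = trans (rel j) (cong (addFixed p) ha)
  lhs : InsertView s Fin.zero j → insertBefore a Fin.zero (insertBefore s Fin.zero (Fin.suc j)) ≡ Fin.zero
  lhs (hit h _) = ⊥-elim (Finₚ.0≢1+n (trans (sym asj) (trans (cong a h) a0)))
  lhs (miss h b) with insertView a Fin.zero (s j)
  ... | hit _ b₂ = trans (cong (insertBefore a Fin.zero) b) b₂
  ... | miss h₂ _ = ⊥-elim (h₂ asj)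
... | vs | miss ha ba with a j | rel j
...   | Fin.zero | _ = ⊥-elim (ha refl)
...   | Fin.suc g | relj = trans (lhs vs) (sym (cong (addFixed (insertBefore p Fin.zero)) ba))
  where
  lhs : InsertView s Fin.zero j →
    insertBefore a Fin.zero (insertBefore s Fin.zero (Fin.suc j)) ≡ Fin.suc (insertBefore p Fin.zero (Fin.suc g))
  lhs (hit h b) with insertView p Fin.zero g
  ... | hit _ b₃ = trans (cong (insertBefore a Fin.zero) b) (cong Fin.suc (sym b₃))
  ... | miss h₃ _ = ⊥-elim (h₃ (Finₚ.suc-injective (trans (sym relj) (trans (cong a h) a0))))
  lhs (miss h b) with insertView a Fin.zero (s j) | insertView p Fin.zero g
  ... | hit h₂ _ | _ = ⊥-elim (Finₚ.0≢1+n (trans (sym h₂) relj))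
  ... | miss _ _ | hit h₃ _ = ⊥-elim (h (inj (trans relj (trans (cong Fin.suc h₃) (sym a0)))))
  ... | miss _ b₂ | miss _ b₃ = trans (cong (insertBefore a Fin.zero) b) (trans b₂ (cong Fin.suc (trans relj (sym b₃))))

-- Rotating by γ turns the interval partition c followed by a final cut into
-- c with a new fixed point in front; this identifies the Kreweras complement.
γ∘intPerm-∷ʳ : (c : Vec Bool m) → ∀ i → γ (intPerm (c ∷ʳ true) i) ≡ addFixed (intPerm c) (γ i)
γ∘intPerm-∷ʳ [] Fin.zero = refl
γ∘intPerm-∷ʳ [] (Fin.suc Fin.zero) = refl
γ∘intPerm-∷ʳ (b ∷ c) i = begin
  γ (intPerm (b ∷ (c ∷ʳ true)) i)                        ≡⟨ cong γ (intPerm-∷ b (c ∷ʳ true) i) ⟩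
  γ (prependCut b (intPerm (c ∷ʳ true)) i)                ≡⟨ γ-suc (prependCut b (intPerm (c ∷ʳ true)) i) ⟩
  insertBefore γ Fin.zero (prependCut b (intPerm (c ∷ʳ true)) i) ≡⟨ step b ⟩
  addFixed (prependCut b (intPerm c)) (insertBefore γ Fin.zero i) ≡⟨ cong (addFixed (prependCut b (intPerm c))) (γ-suc i) ⟨
  addFixed (prependCut b (intPerm c)) (γ i)               ≡⟨ addFixed-cong (intPerm-∷ b c) (γ i) ⟨
  addFixed (intPerm (b ∷ c)) (γ i)                        ∎
  where
  open ≡-Reasoning
  step : ∀ b → insertBefore γ Fin.zero (prependCut b (intPerm (c ∷ʳ true)) i)
             ≡ addFixed (prependCut b (intPerm c)) (insertBefore γ Fin.zero i)
  step true = insertBefore₀-intertwines-addFixed (γ∘intPerm-∷ʳ c) i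
  step false = insertBefore₀-intertwines-insertBefore₀ γ-injective (γ-suc Fin.zero) (γ∘intPerm-∷ʳ c) i

joins-∷ʳ-true : (c : Vec Bool m) → joins (c ∷ʳ true) ≡ joins c
joins-∷ʳ-true [] = refl
joins-∷ʳ-true (true ∷ c) = joins-∷ʳ-true c
joins-∷ʳ-true (false ∷ c) = cong suc (joins-∷ʳ-true c)

krIntPerm-γ-transition : (c : Vec Bool m) → Transition (krIntPerm c) γ (joins c)
krIntPerm-γ-transition [] = record
  { σ = λ i → i ; σ-injective = λ e → e ; α∘σ≗β = λ i → Fin1-≡ _ _ ; numCycles-σ = refl }
krIntPerm-γ-transition (false ∷ c) =
  transition-resp-≗ (λ i → sym (krIntPerm-∷ false c i)) (λ i → sym (γ-suc i))
    (transition-insertBefore τ z (addFixed-∘-insertBefore (α∘σ≗β τ) (krIntPerm-injective c) z↦0))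
  where
  τ = krIntPerm-γ-transition c
  z = proj₁ (krIntPerm-surjective c Fin.zero)
  z↦0 = proj₂ (krIntPerm-surjective c Fin.zero)
krIntPerm-γ-transition (true ∷ c) = record
  { σ = intPerm (c ∷ʳ true)
  ; σ-injective = intPerm-injective (c ∷ʳ true)
  ; α∘σ≗β = λ i → intPerm-injective (true ∷ c) (begin
      intPerm (true ∷ c) (krIntPerm (true ∷ c) (intPerm (c ∷ʳ true) i)) ≡⟨ intPerm∘krIntPerm (true ∷ c) (intPerm (c ∷ʳ true) i) ⟩
      γ (intPerm (c ∷ʳ true) i)                                         ≡⟨ γ∘intPerm-∷ʳ c i ⟩
      addFixed (intPerm c) (γ i)                                        ≡⟨ intPerm-∷ true c (γ i) ⟨
      intPerm (true ∷ c) (γ i)                                          ∎)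
  ; numCycles-σ = trans (cong (numCycles (intPerm (c ∷ʳ true)) ℕ.+_) (sym (joins-∷ʳ-true c))) (numCycles-intPerm (c ∷ʳ true))
  }
  where open ≡-Reasoning

‖krIntPerm⁻¹·γ‖ : (c : Vec Bool m) → ‖ inv (krIntPerm c) · γ ‖ ≡ joins c
‖krIntPerm⁻¹·γ‖ c = ‖inv·‖≡ (krIntPerm-injective c) (krIntPerm-γ-transition c)

Refines : Perm n → Perm n → Set
Refines ρ σ = ∀ i → SameCycle σ i (ρ i)

leqP⇒Refines : (ρ σ : Perm n) → leqP ρ σ ≡ true → Refines ρ σ
leqP⇒Refines ρ σ h i = sameBlock⇒SameCycle σ i (ρ i) (allB-tabulate⁻ (λ x → x) (λ i → sameBlock σ i (ρ i)) h i)

Refines⇒leqP : (ρ σ : Perm n) → Injective _≡_ _≡_ σ → Refines ρ σ → leqP ρ σ ≡ true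
Refines⇒leqP ρ σ inj r =
  allB-tabulate⁺ (λ x → x) (λ i → sameBlock σ i (ρ i)) (λ i → SameCycle⇒sameBlock σ inj i (ρ i) (r i))

Refines-resp-≗ : {ρ ρ' σ σ' : Perm n} → ρ ≗ ρ' → σ ≗ σ' → Refines ρ σ → Refines ρ' σ'
Refines-resp-≗ hρ hσ r i = subst (SameCycle _ i) (hρ i) (sameCycle-cong hσ (r i))

module _ (κ κ' : Perm n) where

  Refines-addFixed⁻ : Refines (addFixed κ) (addFixed κ') → Refines κ κ'
  Refines-addFixed⁻ r i with sameCycle-addFixed-suc⁻ (r (Fin.suc i))
  ... | j , e , s = subst (SameCycle κ' i) (sym (Finₚ.suc-injective e)) s

  Refines-addFixed⁺ : Refines κ κ' → Refines (addFixed κ) (addFixed κ')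
  Refines-addFixed⁺ r Fin.zero = sameCycle-refl _ _
  Refines-addFixed⁺ r (Fin.suc i) = sameCycle-addFixed⁺ (r i)

  Refines-addFixed-insertBefore⁻ : ∀ y' → Refines (addFixed κ) (insertBefore κ' y') → Refines κ κ'
  Refines-addFixed-insertBefore⁻ y' r i with InsertBeforeCycles.sameCycle-suc⁻ κ' y' (r (Fin.suc i))
  ... | inj₁ (j , e , s) = subst (SameCycle κ' i) (sym (Finₚ.suc-injective e)) s
  ... | inj₂ (() , _)

  Refines-addFixed-insertBefore⁺ : ∀ y' → Refines κ κ' → Refines (addFixed κ) (insertBefore κ' y')
  Refines-addFixed-insertBefore⁺ y' r Fin.zero = sameCycle-refl _ _
  Refines-addFixed-insertBefore⁺ y' r (Fin.suc i) = InsertBeforeCycles.sameCycle-suc⁺ κ' y' (r i)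

  ¬Refines-insertBefore-addFixed : ∀ y → ¬ Refines (insertBefore κ y) (addFixed κ')
  ¬Refines-insertBefore-addFixed y r with sameCycle-addFixed-zero⁻ (r Fin.zero)
  ... | ()

  module _ (κ-injective : Injective _≡_ _≡_ κ) (κ'-injective : Injective _≡_ _≡_ κ') (l : Fin n) where
    open InsertBeforeCycles κ' (κ' l)

    Refines-insertBefore⁺ : Refines κ κ' → Refines (insertBefore κ (κ l)) (insertBefore κ' (κ' l))
    Refines-insertBefore⁺ r Fin.zero = sameCycle-zero⁺ (sameCycle-trans (sameCycle-sym κ'-injective (1 , refl)) (r l))
    Refines-insertBefore⁺ r (Fin.suc j) with insertView κ (κ l) j
    ... | hit h b = subst (SameCycle (insertBefore κ' (κ' l)) (Fin.suc j)) (sym b)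
                      (sameCycle-suc-zero⁺ κ'-injective (subst (λ x → SameCycle κ' x (κ' l)) (sym (κ-injective h)) (1 , refl)))
    ... | miss h b = subst (SameCycle (insertBefore κ' (κ' l)) (Fin.suc j)) (sym b) (sameCycle-suc⁺ (r j))

    Refines-insertBefore⁻ : Refines (insertBefore κ (κ l)) (insertBefore κ' (κ' l)) → Refines κ κ'
    Refines-insertBefore⁻ r j with insertView κ (κ l) j
    ... | hit h b = subst (SameCycle κ' j) (sym h) (subst (λ x → SameCycle κ' x (κ l)) (sym (κ-injective h)) l∼κl)
      where
      l∼κl : SameCycle κ' l (κ l)
      l∼κl with sameCycle-zero⁻ (r Fin.zero)
      ... | inj₁ ()
      ... | inj₂ (j' , e , s) = sameCycle-trans (1 , refl) (subst (SameCycle κ' (κ' l)) (sym (Finₚ.suc-injective e)) s)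
    ... | miss h b with sameCycle-suc⁻ (subst (SameCycle (insertBefore κ' (κ' l)) (Fin.suc j)) b (r (Fin.suc j)))
    ...   | inj₁ (j' , e , s) = subst (SameCycle κ' j) (sym (Finₚ.suc-injective e)) s
    ...   | inj₂ (() , _)

krIntPerm-Refines⇔⊆ᵇ : (e c : Vec Bool m) → Refines (krIntPerm e) (krIntPerm c) ⇔ (e ⊆ᵇ c ≡ true)
krIntPerm-Refines⇔⊆ᵇ [] [] = mk⇔ (λ _ → refl) (λ _ i → 0 , Fin1-≡ _ _)
krIntPerm-Refines⇔⊆ᵇ (b ∷ e) (b' ∷ c) = mk⇔
  (λ r → step⁻ b b' (Refines-resp-≗ (krIntPerm-∷ b e) (krIntPerm-∷ b' c) r))
  (λ s → Refines-resp-≗ (λ i → sym (krIntPerm-∷ b e i)) (λ i → sym (krIntPerm-∷ b' c i)) (step⁺ b b' s))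
  where
  κ = krIntPerm e
  κ' = krIntPerm c
  open Equivalence (krIntPerm-Refines⇔⊆ᵇ e c)
  step⁻ : ∀ b b' → Refines (prependKrCut b κ) (prependKrCut b' κ') → (b ∷ e) ⊆ᵇ (b' ∷ c) ≡ true
  step⁻ false false r = to (Refines-addFixed⁻ κ κ' r)
  step⁻ false true r = to (Refines-addFixed-insertBefore⁻ κ κ' _ r)
  step⁻ true false r = ⊥-elim (¬Refines-insertBefore-addFixed κ κ' _ r)
  step⁻ true true r = to (Refines-insertBefore⁻ κ κ' (krIntPerm-injective e) (krIntPerm-injective c) (fromℕ _) r)
  step⁺ : ∀ b b' → (b ∷ e) ⊆ᵇ (b' ∷ c) ≡ true → Refines (prependKrCut b κ) (prependKrCut b' κ')
  step⁺ false false s = Refines-addFixed⁺ κ κ' (from s)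
  step⁺ false true s = Refines-addFixed-insertBefore⁺ κ κ' _ (from s)
  step⁺ true false ()
  step⁺ true true s = Refines-insertBefore⁺ κ κ' (krIntPerm-injective e) (krIntPerm-injective c) (fromℕ _) (from s)

leqP-krIntPerm : (e c : Vec Bool m) → leqP (krIntPerm e) (krIntPerm c) ≡ e ⊆ᵇ c
leqP-krIntPerm e c = ≡true-ext
  (λ h → Equivalence.to (krIntPerm-Refines⇔⊆ᵇ e c) (leqP⇒Refines _ _ h))
  (λ h → Refines⇒leqP _ _ (krIntPerm-injective c) (Equivalence.from (krIntPerm-Refines⇔⊆ᵇ e c) h))

krIntPerm-noCuts : ∀ m → krIntPerm (noCuts m) ≗ idP
krIntPerm-noCuts zero i = Fin1-≡ _ _
krIntPerm-noCuts (suc m) i = trans (krIntPerm-∷ false (noCuts m) i) (addFixed-id i)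
  where
  addFixed-id : ∀ i → addFixed (krIntPerm (noCuts m)) i ≡ i
  addFixed-id Fin.zero = refl
  addFixed-id (Fin.suc i) = cong Fin.suc (krIntPerm-noCuts m i)

leqP-congʳ : (ρ : Perm n) {σ σ' : Perm n} → σ ≗ σ' → leqP ρ σ ≡ leqP ρ σ'
leqP-congʳ {n} ρ σ≗σ' = allB-cong (allFin n) λ i →
  anyB-cong (upTo n) λ k → cong (_== ρ i) (iter-cong k σ≗σ' i)

leqP-krIntPerm-idP : (e : Vec Bool m) → leqP (krIntPerm e) idP ≡ e ⊆ᵇ noCuts m
leqP-krIntPerm-idP {m} e =
  trans (leqP-congʳ (krIntPerm e) (λ i → sym (krIntPerm-noCuts m i))) (leqP-krIntPerm e (noCuts m))

bothBits : List (Vec Bool m) → List (Vec Bool (suc m))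
bothBits = concatMap (λ v → (false ∷ v) ∷ (true ∷ v) ∷ [])

allB-bothBits : (xs : List (Vec Bool m)) (p : Vec Bool (suc m) → Bool) →
  allB (bothBits xs) p ≡ allB xs (λ v → p (false ∷ v) ∧ p (true ∷ v))
allB-bothBits [] p = refl
allB-bothBits (x ∷ xs) p =
  trans (cong (λ r → p (false ∷ x) ∧ (p (true ∷ x) ∧ r)) (allB-bothBits xs p)) (sym (∧-assoc (p (false ∷ x)) _ _))

anyB-bothBits : (xs : List (Vec Bool m)) (p : Vec Bool (suc m) → Bool) →
  anyB (bothBits xs) p ≡ anyB xs (λ v → p (false ∷ v) ∨ p (true ∷ v))
anyB-bothBits [] p = refl
anyB-bothBits (x ∷ xs) p =
  trans (cong (λ r → p (false ∷ x) ∨ (p (true ∷ x) ∨ r)) (anyB-bothBits xs p)) (sym (∨-assoc (p (false ∷ x)) _ _))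

anyB-allCuts-noCuts : ∀ m (p : Vec Bool m → Bool) → p (noCuts m) ≡ true → anyB (allCuts m) p ≡ true
anyB-allCuts-noCuts zero p h rewrite h = refl
anyB-allCuts-noCuts (suc m) p h =
  trans (anyB-bothBits (allCuts m) p) (anyB-allCuts-noCuts m _ (cong (_∨ p (true ∷ noCuts m)) h))

allB-allCuts-noCuts : ∀ m (p : Vec Bool m → Bool) → p (noCuts m) ≡ false → allB (allCuts m) p ≡ false
allB-allCuts-noCuts zero p h rewrite h = refl
allB-allCuts-noCuts (suc m) p h =
  trans (allB-bothBits (allCuts m) p) (allB-allCuts-noCuts m _ (cong (_∧ p (true ∷ noCuts m)) h))

noCuts-⊆ᵇ : (c : Vec Bool m) → noCuts m ⊆ᵇ c ≡ true
noCuts-⊆ᵇ [] = refl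
noCuts-⊆ᵇ (b ∷ c) = noCuts-⊆ᵇ c

onlyEmptyCommonSubset : Vec Bool m → Vec Bool m → Bool
onlyEmptyCommonSubset {m} c d = allB (allCuts m) (λ e → if (e ⊆ᵇ c) ∧ (e ⊆ᵇ d) then e ⊆ᵇ noCuts m else true)

onlyEmptyCommonSubset≡disjoint : (c d : Vec Bool m) → onlyEmptyCommonSubset c d ≡ disjoint c d
onlyEmptyCommonSubset≡disjoint [] [] = refl
onlyEmptyCommonSubset≡disjoint {suc m} (b ∷ c) (b' ∷ d) = trans (allB-bothBits (allCuts m) _) (step b b')
  where
  test : Vec Bool m → Bool
  test e = if (e ⊆ᵇ c) ∧ (e ⊆ᵇ d) then e ⊆ᵇ noCuts m else true
  drop-true : (q : Vec Bool m → Bool) → (∀ e → q e ≡ true) → allB (allCuts m) (λ e → test e ∧ q e) ≡ onlyEmptyCommonSubset c d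
  drop-true q h = allB-cong (allCuts m) (λ e → trans (cong (test e ∧_) (h e)) (∧-identityʳ (test e)))
  step : ∀ b b' →
    allB (allCuts m) (λ e → test e ∧ (if (b ∧ (e ⊆ᵇ c)) ∧ (b' ∧ (e ⊆ᵇ d)) then false ∧ (e ⊆ᵇ noCuts m) else true))
      ≡ not (b ∧ b') ∧ disjoint c d
  step false b' = trans (drop-true _ (λ e → refl)) (onlyEmptyCommonSubset≡disjoint c d)
  step true false = trans (drop-true _ (λ e → cong (λ x → if x then false else true) (∧-zeroʳ (e ⊆ᵇ c))))
                          (onlyEmptyCommonSubset≡disjoint c d)
  step true true = allB-allCuts-noCuts m _
    (trans (cong (λ x → test (noCuts m) ∧ (if x then false else true)) (cong₂ _∧_ (noCuts-⊆ᵇ c) (noCuts-⊆ᵇ d)))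
           (∧-zeroʳ (test (noCuts m))))

meetKrIntIsZero≡disjoint : (c d : Vec Bool m) → meetKrIntIsZero (krIntPerm c) (krIntPerm d) ≡ disjoint c d
meetKrIntIsZero≡disjoint {m} c d = trans (cong₂ _∧_ zero-below-both meet-test) (onlyEmptyCommonSubset≡disjoint c d)
  where
  zero-in-KrInt : eqP idP (krIntPerm (noCuts m)) ≡ true
  zero-in-KrInt = allB-tabulate⁺ (λ x → x) (λ i → i == krIntPerm (noCuts m) i)
    (λ i → subst (λ z → i == z ≡ true) (sym (krIntPerm-noCuts m i)) (==-refl i))
  zero-below-both : (inKrInt {m} idP ∧ leqP idP (krIntPerm c) ∧ leqP idP (krIntPerm d)) ≡ true
  zero-below-both = ∧≡true⁺ (anyB-allCuts-noCuts m _ zero-in-KrInt)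
    (∧≡true⁺ (Refines⇒leqP _ _ (krIntPerm-injective c) (sameCycle-refl _))
             (Refines⇒leqP _ _ (krIntPerm-injective d) (sameCycle-refl _)))
  meet-test : allB (allCuts m) (λ e → if leqP (krIntPerm e) (krIntPerm c) ∧ leqP (krIntPerm e) (krIntPerm d)
                                      then leqP (krIntPerm e) idP else true)
              ≡ onlyEmptyCommonSubset c d
  meet-test = allB-cong (allCuts m) (λ e → cong₂ (λ x y → if x then y else true)
    (cong₂ _∧_ (leqP-krIntPerm e c) (leqP-krIntPerm e d)) (leqP-krIntPerm-idP e))

module Coefficients {c ℓ : Level} (R : CommutativeSemiring c ℓ) where
  open CommutativeSemiring R renaming (refl to ≈-refl; sym to ≈-sym; trans to ≈-trans)
  open Series R
  open import Relation.Binary.Reasoning.Setoid setoid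
  open import Algebra.Solver.Ring.NaturalCoefficients.Default R using (solve; _:=_; _:+_; _:*_; con)

  sumL-cong : {A : Set} (xs : List A) {f g : A → Carrier} → (∀ x → f x ≈ g x) → sumL xs f ≈ sumL xs g
  sumL-cong [] h = ≈-refl
  sumL-cong (x ∷ xs) h = +-cong (h x) (sumL-cong xs h)

  sumL-*ˡ : {A : Set} (xs : List A) (w : Carrier) (f : A → Carrier) → sumL xs (λ x → w * f x) ≈ w * sumL xs f
  sumL-*ˡ [] w f = ≈-sym (zeroʳ w)
  sumL-*ˡ (x ∷ xs) w f = ≈-trans (+-cong ≈-refl (sumL-*ˡ xs w f)) (≈-sym (distribˡ w (f x) (sumL xs f)))

  sumL-bothBits : (xs : List (Vec Bool m)) (f : Vec Bool (suc m) → Carrier) →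
    sumL (bothBits xs) f ≈ sumL xs (λ v → f (false ∷ v) + f (true ∷ v))
  sumL-bothBits [] f = ≈-refl
  sumL-bothBits (x ∷ xs) f = ≈-trans (+-cong ≈-refl (+-cong ≈-refl (sumL-bothBits xs f))) (≈-sym (+-assoc _ _ _))

  doubleSum : ∀ m → (Vec Bool m → Vec Bool m → Carrier) → Carrier
  doubleSum m S = sumL (allCuts m) λ c → sumL (allCuts m) λ d → S c d

  doubleSum-cong : ∀ m {S T : Vec Bool m → Vec Bool m → Carrier} → (∀ c d → S c d ≈ T c d) → doubleSum m S ≈ doubleSum m T
  doubleSum-cong m h = sumL-cong (allCuts m) λ c → sumL-cong (allCuts m) (h c)

  pow-cong : ∀ {x x'} → x ≈ x' → ∀ k → pow x k ≈ pow x' k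
  pow-cong x≈x' ℕ.zero = ≈-refl
  pow-cong x≈x' (suc k) = *-cong x≈x' (pow-cong x≈x' k)

  totalWeight : (Bool → Bool → Carrier) → Carrier
  totalWeight w = (w false false + w false true) + (w true false + w true true)

  doubleSum-suc : ∀ m (S : Vec Bool (suc m) → Vec Bool (suc m) → Carrier) (T : Vec Bool m → Vec Bool m → Carrier)
    (w : Bool → Bool → Carrier) → (∀ b b' c d → S (b ∷ c) (b' ∷ d) ≈ w b b' * T c d) →
    doubleSum (suc m) S ≈ totalWeight w * doubleSum m T
  doubleSum-suc m S T w h = begin
    doubleSum (suc m) S                                                  ≈⟨ sumL-bothBits (allCuts m) _ ⟩
    sumL (allCuts m) (λ c → row false c + row true c)                    ≈⟨ sumL-cong (allCuts m) (λ c → +-cong (row≈ false c) (row≈ true c)) ⟩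
    sumL (allCuts m) (λ c → (w false false + w false true) * X c + (w true false + w true true) * X c)
                                                                         ≈⟨ sumL-cong (allCuts m) (λ c → ≈-sym (distribʳ (X c) _ _)) ⟩
    sumL (allCuts m) (λ c → totalWeight w * X c)                         ≈⟨ sumL-*ˡ (allCuts m) _ X ⟩
    totalWeight w * doubleSum m T                                        ∎
    where
    row : Bool → Vec Bool m → Carrier
    row b c = sumL (allCuts (suc m)) (λ d' → S (b ∷ c) d')
    X : Vec Bool m → Carrier
    X c = sumL (allCuts m) (λ d → T c d)
    row≈ : ∀ b c → row b c ≈ (w b false + w b true) * X c
    row≈ b c = begin
      row b c                                                          ≈⟨ sumL-bothBits (allCuts m) _ ⟩
      sumL (allCuts m) (λ d → S (b ∷ c) (false ∷ d) + S (b ∷ c) (true ∷ d))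
        ≈⟨ sumL-cong (allCuts m) (λ d → ≈-trans (+-cong (h b false c d) (h b true c d)) (≈-sym (distribʳ (T c d) _ _))) ⟩
      sumL (allCuts m) (λ d → (w b false + w b true) * T c d)          ≈⟨ sumL-*ˡ (allCuts m) _ (T c) ⟩
      (w b false + w b true) * X c                                     ∎

  doubleSum-pow : (F : ∀ {m} → Vec Bool m → Vec Bool m → Carrier) (w : Bool → Bool → Carrier) →
    F [] [] ≈ 1# → (∀ {m} b b' (c d : Vec Bool m) → F (b ∷ c) (b' ∷ d) ≈ w b b' * F c d) →
    ∀ m → doubleSum m F ≈ pow (totalWeight w) m
  doubleSum-pow F w F[] F∷ ℕ.zero = ≈-trans (+-identityʳ _) (≈-trans (+-identityʳ _) F[])
  doubleSum-pow F w F[] F∷ (suc m) =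
    ≈-trans (doubleSum-suc m F F w F∷) (*-congˡ (doubleSum-pow F w F[] F∷ m))

  module _ (y a b : Carrier) where

    termM : Vec Bool m → Vec Bool m → Carrier
    termM c d = pow y (hamming c d) * pow a (joins c) * pow b (joins d)

    weightM : Bool → Bool → Carrier
    weightM true true = 1#
    weightM false false = a * b
    weightM false true = a * y
    weightM true false = b * y

    termM-[] : termM [] [] ≈ 1#
    termM-[] = ≈-trans (*-identityʳ _) (*-identityʳ _)

    termM-∷ : ∀ b₁ b₂ (c d : Vec Bool m) → termM (b₁ ∷ c) (b₂ ∷ d) ≈ weightM b₁ b₂ * termM c d
    termM-∷ true true c d = ≈-sym (*-identityˡ _)
    termM-∷ false false c d = solve 5 (λ a b Y A B → Y :* (a :* A) :* (b :* B) := (a :* b) :* (Y :* A :* B))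
      ≈-refl a b (pow y (hamming c d)) (pow a (joins c)) (pow b (joins d))
    termM-∷ false true c d = solve 5 (λ a y Y A B → (y :* Y) :* (a :* A) :* B := (a :* y) :* (Y :* A :* B))
      ≈-refl a y (pow y (hamming c d)) (pow a (joins c)) (pow b (joins d))
    termM-∷ true false c d = solve 5 (λ b y Y A B → (y :* Y) :* A :* (b :* B) := (b :* y) :* (Y :* A :* B))
      ≈-refl b y (pow y (hamming c d)) (pow a (joins c)) (pow b (joins d))

    totalWeightM : totalWeight weightM ≈ 1# + a * b + (a + b) * y
    totalWeightM = solve 3 (λ a b y → (a :* b :+ a :* y) :+ (b :* y :+ con 1) := con 1 :+ a :* b :+ (a :+ b) :* y)
      ≈-refl a b y

    termK : Vec Bool m → Vec Bool m → Carrier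
    termK c d = if disjoint c d then termM c d else 0#

    weightK : Bool → Bool → Carrier
    weightK true true = 0#
    weightK b₁ b₂ = weightM b₁ b₂

    termM-∷-if : ∀ b₁ b₂ (c d : Vec Bool m) t →
      (if t then termM (b₁ ∷ c) (b₂ ∷ d) else 0#) ≈ weightM b₁ b₂ * (if t then termM c d else 0#)
    termM-∷-if b₁ b₂ c d true = termM-∷ b₁ b₂ c d
    termM-∷-if b₁ b₂ c d false = ≈-sym (zeroʳ _)

    termK-∷ : ∀ b₁ b₂ (c d : Vec Bool m) → termK (b₁ ∷ c) (b₂ ∷ d) ≈ weightK b₁ b₂ * termK c d
    termK-∷ true true c d = ≈-sym (zeroˡ _)
    termK-∷ false false c d = termM-∷-if false false c d (disjoint c d)
    termK-∷ false true c d = termM-∷-if false true c d (disjoint c d)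
    termK-∷ true false c d = termM-∷-if true false c d (disjoint c d)

    totalWeightK : totalWeight weightK ≈ a * b + (a + b) * y
    totalWeightK = solve 3 (λ a b y → (a :* b :+ a :* y) :+ (b :* y :+ con 0) := a :* b :+ (a :+ b) :* y)
      ≈-refl a b y

    Mcoeff≈doubleSum : ∀ m → Mcoeff y a b m ≈ doubleSum m termM
    Mcoeff≈doubleSum m = doubleSum-cong m λ c d → reflexive
      (cong₂ _*_ (cong₂ (λ u v → pow y u * pow a v) (‖intPerm⁻¹·intPerm‖ c d) (‖intPerm‖ c)) (cong (pow b) (‖intPerm‖ d)))

    Kcoeff≈doubleSum : ∀ m → Kcoeff y a b m ≈ doubleSum m termK
    Kcoeff≈doubleSum m = doubleSum-cong m λ c d →
      ≈-trans (reflexive (cong (λ t → if t then summand c d else 0#) (meetKrIntIsZero≡disjoint c d)))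
              (by-cases c d (disjoint c d) refl)
      where
      summand : (c d : Vec Bool m) → Carrier
      summand c d = pow y ‖ inv (krIntPerm c) · krIntPerm d ‖ * pow a ‖ inv (krIntPerm c) · γ ‖ * pow b ‖ inv (krIntPerm d) · γ ‖
      by-cases : (c d : Vec Bool m) → ∀ t → disjoint c d ≡ t → (if t then summand c d else 0#) ≈ (if t then termM c d else 0#)
      by-cases c d true c⊥d = reflexive (cong₂ _*_
        (cong₂ (λ u v → pow y u * pow a v) (‖krIntPerm⁻¹·krIntPerm‖ c d c⊥d) (‖krIntPerm⁻¹·γ‖ c))
        (cong (pow b) (‖krIntPerm⁻¹·γ‖ d)))
      by-cases c d false _ = ≈-refl

    Mcoeff-closedForm : ∀ m → Mcoeff y a b m ≈ pow (1# + a * b + (a + b) * y) m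
    Mcoeff-closedForm m = begin
      Mcoeff y a b m                       ≈⟨ Mcoeff≈doubleSum m ⟩
      doubleSum m termM                    ≈⟨ doubleSum-pow termM weightM termM-[] termM-∷ m ⟩
      pow (totalWeight weightM) m          ≈⟨ pow-cong totalWeightM m ⟩
      pow (1# + a * b + (a + b) * y) m     ∎

    Kcoeff-closedForm : ∀ m → Kcoeff y a b m ≈ pow (a * b + (a + b) * y) m
    Kcoeff-closedForm m = begin
      Kcoeff y a b m                       ≈⟨ Kcoeff≈doubleSum m ⟩
      doubleSum m termK                    ≈⟨ doubleSum-pow termK weightK termM-[] termK-∷ m ⟩
      pow (totalWeight weightK) m          ≈⟨ pow-cong totalWeightK m ⟩
      pow (a * b + (a + b) * y) m          ∎

theorem4p1 : {c ℓ : Level} (R : CommutativeSemiring c ℓ) →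
    let open CommutativeSemiring R in
    let open Series R in
    (y a b : Carrier) (m : ℕ) →
    (Mcoeff y a b m ≈ pow (1# + a * b + (a + b) * y) m)
    × (Kcoeff y a b m ≈ pow (a * b + (a + b) * y) m)
theorem4p1 R y a b m = Mcoeff-closedForm y a b m , Kcoeff-closedForm y a b m
  where open Coefficients R
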